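{- Let $n\ge3$ and $A\in\mathscr S^*(n)$ with parameters $c=c(A)$, $v=v(A)$, $s=s(A)$, $\bar c=c(\bar A)$, $\bar v=v(\bar A)$, $\bar s=s(\bar A)$, and let $v'$ be an integer with $n-\bar c\le v'<v$, and suppose $\bar v=n-c-1$. Then there exists $A_2\in\mathscr S^*(n)$ whose parameters $c_2,v_2,s_2,\bar c_2,\bar v_2,\bar s_2$ (defined analogously for $A_2$ and $\bar A_2$) satisfy $c_2=c$, $v_2=v'$, $s_2+v_2=s+v$, $\bar c_2=\bar c$, $\bar v_2=\bar v$, $\bar s_2=\bar s$. Moreover, $\phi(A)\le\phi(A_2)$, $\phi(\bar A)=\phi(\bar A_2)$, and $\phi(A)=\phi(A_2)$ if and only if $v+s=2c$.
   Context: $\mathscr S(n)$ is the set of $n\times n$ $(0,1)$-matrices with zero diagonal. $\mathscr S^*(n)$ is the set of $A=(a_{ij})\in\mathscr S(n)$ with $a_{12}=a_{21}=1$, $a_{n-1,n}=a_{n,n-1}=0$, and such that whenever $a_{ij}=1$, also $a_{hk}=1$ for all $h\le i$, $k\le j$ with $h\neq k$. For $A\in\mathscr S^*(n)$ with row sums $r_1,\dots,r_n$: $c(A)=\max\{i\in[n]: r_1+\cdots+r_i>i(i-1)\}$, $v(A)=r_{c(A)+1}$, $s(A)=\sum_{i=1}^{c(A)}r_i-c(A)(c(A)-1)$, and $\phi(A)=\frac12\left(v-1+\sqrt{(2c-v-1)^2+4s}\right)$ with $c=c(A),v=v(A),s=s(A)$. For $A=(a_{ij})\in\mathscr S^*(n)$,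 $\bar A=(\bar a_{ij})$ is the $n\times n$ matrix with zero diagonal and $\bar a_{ij}=1-a_{n-j+1,n-i+1}$ for $i\neq j$; it again lies in $\mathscr S^*(n)$. -}

module Defs where

open import Data.Bool using (Bool; true; false; if_then_else_; not)
open import Data.Nat as ℕ using (ℕ; zero; suc; _+_; _*_; _∸_; _≤_; _<_; _<ᵇ_; _<?_)
open import Data.Fin using (Fin; toℕ; fromℕ<; opposite)
open import Data.Fin.Properties using (_≟_)
open import Data.List using (List; map; allFin)
open import Data.Nat.ListAction using (sum)
open import Data.Integer as ℤ using (ℤ; +_; ∣_∣)
open import Data.Rational as ℚ using (ℚ)
open import Data.Sum using (_⊎_)
open import Data.Product using (_×_)
open import Relation.Binary.PropositionalEquality using (_≡_; _≢_)
open import Relation.Nullary using (yes; no)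

-- (0,1)-matrices of size n × n, indices 0-based (Fin n); entry true = 1.

Mat : ℕ → Set
Mat n = Fin n → Fin n → Bool

b2n : Bool → ℕ
b2n true  = 1
b2n false = 0

InS : ∀ {n} → Mat n → Set
InS A = ∀ i → A i i ≡ false

-- 𝒮*(n).  Paper index p (1-based) corresponds to Fin index with toℕ = p - 1.
InSstar : ∀ {n} → Mat n → Set
InSstar {n} A =
  InS A
  × (∀ i j → toℕ i ≡ 0 → toℕ j ≡ 1 → A i j ≡ true)
  × (∀ i j → toℕ i ≡ 1 → toℕ j ≡ 0 → A i j ≡ true)
  × (∀ i j → suc (suc (toℕ i)) ≡ n → suc (toℕ j) ≡ n → A i j ≡ false)  -- a_{n-1,n} = 0
  × (∀ i j → suc (toℕ i) ≡ n → suc (suc (toℕ j)) ≡ n → A i j ≡ false)  -- a_{n,n-1} = 0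
  × (∀ i j h k → A i j ≡ true → toℕ h ≤ toℕ i → toℕ k ≤ toℕ j → h ≢ k
       → A h k ≡ true)

rowSum : ∀ {n} → Mat n → Fin n → ℕ
rowSum {n} A i = sum (map (λ j → b2n (A i j)) (allFin n))

-- row sum of the row with 0-based index t (0 if t ≥ n); so paper's r_p = row A (p - 1)
row : ∀ {n} → Mat n → ℕ → ℕ
row {n} A t with t <? n
... | yes p = rowSum A (fromℕ< p)
... | no _  = 0

-- prefix sum r₁ + ⋯ + r_i  (paper indices)
prefix : ∀ {n} → Mat n → ℕ → ℕ
prefix A zero    = 0
prefix A (suc i) = prefix A i + row A i

maxSat : (ℕ → Bool) → ℕ → ℕ
maxSat p zero    = 0
maxSat p (suc k) = if p (suc k) then suc k else maxSat p k

cOf : ∀ {n} → Mat n → ℕ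
cOf {n} A = maxSat (λ i → (i * (i ∸ 1)) <ᵇ prefix A i) n

-- v(A) = r_{c(A)+1}
vOf : ∀ {n} → Mat n → ℕ
vOf A = row A (cOf A)

-- s(A) = r₁ + ⋯ + r_c − c(c−1)   (positive by definition of c)
sOf : ∀ {n} → Mat n → ℕ
sOf A = prefix A (cOf A) ∸ cOf A * (cOf A ∸ 1)

-- Ā : ā_ij = 1 − a_{n−j+1, n−i+1} for i ≠ j, zero diagonal
bar : ∀ {n} → Mat n → Mat n
bar A i j with i ≟ j
... | yes _ = false
... | no _  = not (A (opposite j) (opposite i))

-- Real numbers of the form (a + √D)/2 with a ∈ ℤ, D ∈ ℕ, compared via
-- their lower Dedekind cuts in ℚ.

record Surd : Set where
  constructor surd
  field
    a : ℤ
    D : ℕ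

-- q ≤ (a + √D)/2   ⇔   2q − a ≤ √D   ⇔   2q − a ≤ 0  ∨  (2q − a)² ≤ D
_≤val_ : ℚ → Surd → Set
q ≤val surd a D =
  let r = ℚ._-_ (ℚ._*_ (+ 2 ℚ./ 1) q) (a ℚ./ 1)
  in (r ℚ.≤ ℚ.0ℚ) ⊎ (ℚ._*_ r r ℚ.≤ (+ D ℚ./ 1))

infix 4 _≤ℝ_ _≈ℝ_
_≤ℝ_ : Surd → Surd → Set
x ≤ℝ y = ∀ q → q ≤val x → q ≤val y

_≈ℝ_ : Surd → Surd → Set
x ≈ℝ y = (x ≤ℝ y) × (y ≤ℝ x)

φ : ∀ {n} → Mat n → Surd
φ A =
  let c = cOf A ; v = vOf A ; s = sOf A
      t = ℤ._-_ (+ (2 * c)) (+ (v + 1))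
  in surd (ℤ._-_ (+ v) (+ 1)) (∣ t ∣ * ∣ t ∣ + 4 * s)

-- A₂ is reached from A in v − v′ steps, each moving the last one of row c + 1 to the first
-- free zero, in row-major order, of rows 1, …, c.  A step keeps A in 𝒮*, keeps c, raises s and
-- lowers v by one; in Ā it moves a one between two rows above row c̄, so c̄, v̄ and s̄ stay put.
-- A free zero exists because v > n − c̄, and v̄ = n − c − 1 forbids ones to the right of the
-- removed one in lower rows, which keeps the moved matrix closed.
--
-- With w = 2c − v − 1 and d = v − v′, 2φ(A) = v′ − 1 + d + √(w² + 4s) and
-- 2φ(A₂) = v′ − 1 + √((w + d)² + 4(s + d)), while
-- (√(w² + 4s) + d)² = (w + d)² + 4(s + d) − 2d(w + 2 − √(w² + 4s)).  Now s + v ≤ 2c says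
-- s ≤ w + 1, i.e. √(w² + 4s) ≤ w + 2, with equality exactly when v + s = 2c.  As surds are
-- compared through rational cuts, strictness needs a rational strictly between the two values.

module Submission where

open import Defs
open import Data.Bool using (Bool; true; false; not) renaming (_≟_ to _≟ᵇ_)
open import Data.Bool.Properties using (T-≡; ¬-not)
open import Data.Empty using (⊥-elim)
open import Data.Fin using (Fin; zero; suc; toℕ; fromℕ<; opposite)
open import Data.Fin.Properties
  using (_≟_; any?; toℕ-injective; toℕ-fromℕ<; fromℕ<-toℕ; toℕ<n; toℕ-inject; ¬∀⟶∃¬-smallest;
         opposite-prop; opposite-involutive)
open import Data.Integer as ℤ using (ℤ; +_; -[1+_]; 0ℤ; +≤+; -≤+)
import Data.Integer.Properties as ℤ
import Data.Integer.Solver as ℤ-Solver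
open import Data.List using (tabulate)
open import Data.List.Properties using (map-tabulate)
open import Data.Nat.ListAction using (sum)
open import Data.Nat
  using (ℕ; zero; suc; _+_; _*_; _∸_; _≤_; _<_; _≡ᵇ_; _<ᵇ_; _<?_; _≤?_; z≤n; s≤s; z<s;
         NonZero; ≢-nonZero; >-nonZero)
  renaming (_≟_ to _≟ℕ_)
open import Data.Nat.Properties hiding (_≟_)
open import Algebra.Properties.CommutativeSemigroup +-commutativeSemigroup using (interchange)
open import Data.Nat.Solver using (module +-*-Solver)
open import Data.Product using (Σ; ∃; _×_; _,_; proj₁; proj₂)
open import Data.Rational as ℚ using (ℚ)
import Data.Rational.Properties as ℚ
open import Data.Rational.Unnormalised as ℚᵘ using (ℚᵘ; mkℚᵘ; *≡*; *≤*)
import Data.Rational.Unnormalised.Properties as ℚᵘ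
open import Data.Sum using (_⊎_; inj₁; inj₂; [_,_]′)
open import Data.Vec.Functional using (updateAt)
open import Data.Vec.Functional.Properties using (updateAt-updates; updateAt-minimal)
open import Function using (_∘_; const; case_of_)
open import Function.Bundles using (_⇔_; mk⇔; Equivalence)
import Function.Properties.Equivalence as ⇔
open import Relation.Binary.PropositionalEquality
open import Relation.Nullary using (¬_; yes; no; Dec; contradiction)
open import Relation.Nullary.Decidable using (decidable-stable; ¬?; _×-dec_)
open import Relation.Unary using (Pred; Decidable)

-- Surds

infix 4 ⟨_/_⟩≤√_

-- ⟨ R / m ⟩≤√ D says R/m ≤ √D, with the denominator cleared.
data ⟨_/_⟩≤√_ (R : ℤ) (m D : ℕ) : Set where
  nonpos  : R ℤ.≤ 0ℤ → ⟨ R / m ⟩≤√ D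
  square≤ : R ℤ.* R ℤ.≤ + (D * (m * m)) → ⟨ R / m ⟩≤√ D

toℚᵘ-2q-a : ∀ (a i : ℤ) (k : ℕ) →
  ℚ.toℚᵘ (ℚ._-_ (ℚ._*_ (+ 2 ℚ./ 1) (i ℚ./ suc k)) (a ℚ./ 1))
    ℚᵘ.≃ mkℚᵘ (+ 2 ℤ.* i ℤ.- a ℤ.* + suc k) k
toℚᵘ-2q-a a i k = ℚᵘ.≃-trans (ℚ.toℚᵘ-homo-+ (ℚ._*_ two q) (ℚ.-_ a'))
    (ℚᵘ.≃-trans (ℚᵘ.+-cong (ℚᵘ.≃-trans (ℚ.toℚᵘ-homo-* two q)
                                        (ℚᵘ.*-cong (ℚ.toℚᵘ-fromℚᵘ (mkℚᵘ (+ 2) 0)) (ℚ.toℚᵘ-fromℚᵘ (mkℚᵘ i k))))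
                           (ℚᵘ.≃-trans (ℚ.toℚᵘ-homo‿- a') (ℚᵘ.-‿cong (ℚ.toℚᵘ-fromℚᵘ (mkℚᵘ a 0)))))
      (*≡* (numerators (*-identityˡ (suc k)) (trans (*-identityʳ _) (*-identityˡ (suc k))))))
  where
    open ℤ-Solver.+-*-Solver
    two : ℚ
    two = + 2 ℚ./ 1
    q : ℚ
    q = i ℚ./ suc k
    a' : ℚ
    a' = a ℚ./ 1
    -- m₁ and m₂ stand for the denominators 1 * suc k and 1 * suc k * 1, which do not reduce.
    numerators : ∀ {m₁ m₂} → m₁ ≡ suc k → m₂ ≡ suc k →
                 ((+ 2 ℤ.* i) ℤ.* + 1 ℤ.+ (ℤ.- a) ℤ.* + m₁) ℤ.* + suc k
                 ≡ (+ 2 ℤ.* i ℤ.- a ℤ.* + suc k) ℤ.* + m₂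
    numerators refl refl =
      solve 3 (λ i a m → ((con (+ 2) :* i) :* con (+ 1) :+ (:- a) :* m) :* m
                        := ((con (+ 2) :* i) :- a :* m) :* m) refl i a (+ suc k)

toℚᵘ-≤⇔ : ∀ {p q : ℚ} {P Q : ℚᵘ} → ℚ.toℚᵘ p ℚᵘ.≃ P → ℚ.toℚᵘ q ℚᵘ.≃ Q →
          (p ℚ.≤ q) ⇔ (P ℚᵘ.≤ Q)
toℚᵘ-≤⇔ p≃P q≃Q = mk⇔
  (λ p≤q → ℚᵘ.≤-respʳ-≃ q≃Q (ℚᵘ.≤-respˡ-≃ p≃P (ℚ.toℚᵘ-mono-≤ p≤q)))
  (λ P≤Q → ℚ.toℚᵘ-cancel-≤ (ℚᵘ.≤-respʳ-≃ (ℚᵘ.≃-sym q≃Q) (ℚᵘ.≤-respˡ-≃ (ℚᵘ.≃-sym p≃P) P≤Q)))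

≤ᵘ⇔ : ∀ {p q : ℚᵘ} → (p ℚᵘ.≤ q) ⇔ (ℚᵘ.↥ p ℤ.* ℚᵘ.↧ q ℤ.≤ ℚᵘ.↥ q ℤ.* ℚᵘ.↧ p)
≤ᵘ⇔ = mk⇔ ℚᵘ.drop-*≤* *≤*

≤val⇔≤√ : ∀ a D i m .{{_ : NonZero m}} →
          (i ℚ./ m) ≤val surd a D ⇔ ⟨ + 2 ℤ.* i ℤ.- a ℤ.* + m / m ⟩≤√ D
≤val⇔≤√ a D i (suc k) = mk⇔
  [ nonpos ∘ Equivalence.to nonpos⇔ , square≤ ∘ Equivalence.to square⇔ ]′
  λ { (nonpos h) → inj₁ (Equivalence.from nonpos⇔ h) ; (square≤ h) → inj₂ (Equivalence.from square⇔ h) }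
  where
    R : ℤ
    R = + 2 ℤ.* i ℤ.- a ℤ.* + suc k
    r : ℚ
    r = ℚ._-_ (ℚ._*_ (+ 2 ℚ./ 1) (i ℚ./ suc k)) (a ℚ./ 1)
    r≃ : ℚ.toℚᵘ r ℚᵘ.≃ mkℚᵘ R k
    r≃ = toℚᵘ-2q-a a i k
    rr≃ : ℚ.toℚᵘ (ℚ._*_ r r) ℚᵘ.≃ mkℚᵘ R k ℚᵘ.* mkℚᵘ R k
    rr≃ = ℚᵘ.≃-trans (ℚ.toℚᵘ-homo-* r r) (ℚᵘ.*-cong r≃ r≃)
    ≡-⇔ : ∀ {x x' y y'} → x ≡ x' → y ≡ y' → (x ℤ.≤ y) ⇔ (x' ℤ.≤ y')
    ≡-⇔ refl refl = ⇔.refl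
    nonpos⇔ : (r ℚ.≤ ℚ.0ℚ) ⇔ (R ℤ.≤ 0ℤ)
    nonpos⇔ = ⇔.trans (toℚᵘ-≤⇔ r≃ ℚᵘ.≃-refl) (⇔.trans ≤ᵘ⇔ (≡-⇔ (ℤ.*-identityʳ R) refl))
    square⇔ : (ℚ._*_ r r ℚ.≤ (+ D ℚ./ 1)) ⇔ (R ℤ.* R ℤ.≤ + (D * (suc k * suc k)))
    square⇔ = ⇔.trans (toℚᵘ-≤⇔ rr≃ (ℚ.toℚᵘ-fromℚᵘ (mkℚᵘ (+ D) 0)))
                (⇔.trans ≤ᵘ⇔ (≡-⇔ (ℤ.*-identityʳ (R ℤ.* R)) (sym (ℤ.pos-* D (suc k * suc k)))))

m*m≤n*n⇒m≤n : ∀ {m n} → m * m ≤ n * n → m ≤ n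
m*m≤n*n⇒m≤n {m} {n} mm≤nn = ≮⇒≥ (λ n<m → <⇒≱ (*-mono-< n<m n<m) mm≤nn)

≤√-pos⇔ : ∀ x m D → ⟨ + x / m ⟩≤√ D ⇔ x * x ≤ D * (m * m)
≤√-pos⇔ x m D = mk⇔ to (λ h → square≤ (subst (ℤ._≤ _) (ℤ.pos-* x x) (+≤+ h)))
  where
    to : ⟨ + x / m ⟩≤√ D → x * x ≤ D * (m * m)
    to (nonpos (+≤+ z≤n)) = z≤n
    to (square≤ h) = ℤ.drop‿+≤+ (subst (ℤ._≤ _) (sym (ℤ.pos-* x x)) h)

≤√-bound : ∀ {z k m D} → z ℤ.≤ + k → k * k ≤ D * (m * m) → ⟨ z / m ⟩≤√ D
≤√-bound -≤+ _ = nonpos -≤+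
≤√-bound {+ y} {k} {m} {D} (+≤+ y≤k) kk≤ =
  Equivalence.from (≤√-pos⇔ y m D) (≤-trans (*-mono-≤ y≤k y≤k) kk≤)

≤√-square⇔ : ∀ R m t → ⟨ R / m ⟩≤√ (t * t) ⇔ R ℤ.≤ + (t * m)
≤√-square⇔ -[1+ _ ] m t = mk⇔ (λ _ → -≤+) (λ _ → nonpos -≤+)
≤√-square⇔ (+ x) m t = ⇔.trans (≤√-pos⇔ x m (t * t))
  (mk⇔ (λ h → +≤+ (m*m≤n*n⇒m≤n (subst (x * x ≤_) square h)))
       (λ { (+≤+ h) → subst (x * x ≤_) (sym square) (*-mono-≤ h h) }))
  where
    open +-*-Solver
    square : t * t * (m * m) ≡ t * m * (t * m)
    square = solve 2 (λ t m → t :* t :* (m :* m) := t :* m :* (t :* m)) refl t m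

≤ℝ-intro : ∀ {a D b E} →
           (∀ i m .{{_ : NonZero m}} → ⟨ + 2 ℤ.* i ℤ.- a ℤ.* + m / m ⟩≤√ D
                                      → ⟨ + 2 ℤ.* i ℤ.- b ℤ.* + m / m ⟩≤√ E) →
           surd a D ≤ℝ surd b E
≤ℝ-intro {a} {D} {b} {E} h q q≤ = subst (_≤val surd b E) (ℚ.↥p/↧p≡p q)
  (Equivalence.from (≤val⇔≤√ b E i m)
    (h i m (Equivalence.to (≤val⇔≤√ a D i m) (subst (_≤val surd a D) (sym (ℚ.↥p/↧p≡p q)) q≤))))
  where
    i : ℤ
    i = ℚ.↥ q
    m : ℕ
    m = suc (ℚ.denominator-1 q)

-- φ has radicand disc w s, where w = |2c − v − 1|.
disc : ℕ → ℕ → ℕ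
disc w s = w * w + 4 * s

module _ where
  open ≤-Reasoning
  open +-*-Solver

  square-+ : ∀ a b → (a + b) * (a + b) ≡ a * a + 2 * a * b + b * b
  square-+ = solve 2 (λ a b → (a :+ b) :* (a :+ b) := a :* a :+ con 2 :* a :* b :+ b :* b) refl

  disc-shift : ∀ w s d m → disc (w + d) (s + d) * (m * m)
                           ≡ disc w s * (m * m) + 2 * ((w + 2) * m) * (d * m) + d * m * (d * m)
  disc-shift = solve 4 (λ w s d m →
    ((w :+ d) :* (w :+ d) :+ con 4 :* (s :+ d)) :* (m :* m)
      := (w :* w :+ con 4 :* s) :* (m :* m) :+ con 2 :* ((w :+ con 2) :* m) :* (d :* m) :+ d :* m :* (d :* m))
    refl

  disc-≤-square : ∀ {w s} → s ≤ suc w → disc w s ≤ (w + 2) * (w + 2)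
  disc-≤-square {w} {s} s≤1+w = begin
    w * w + 4 * s      ≤⟨ +-monoʳ-≤ (w * w) (*-monoʳ-≤ 4 s≤1+w) ⟩
    w * w + 4 * suc w  ≡⟨ solve 1 (λ w → w :* w :+ con 4 :* (con 1 :+ w) := (w :+ con 2) :* (w :+ con 2)) refl w ⟩
    (w + 2) * (w + 2)  ∎

  disc-shift-≤ : ∀ {w s} d m {x} → s ≤ suc w → x * x ≤ disc w s * (m * m) →
                 (x + d * m) * (x + d * m) ≤ disc (w + d) (s + d) * (m * m)
  disc-shift-≤ {w} {s} d m {x} s≤1+w xx≤ = begin
    (x + d * m) * (x + d * m)                                          ≡⟨ square-+ x (d * m) ⟩
    x * x + 2 * x * (d * m) + d * m * (d * m)
      ≤⟨ +-monoˡ-≤ (d * m * (d * m)) (+-mono-≤ xx≤ (*-monoˡ-≤ (d * m) (*-monoʳ-≤ 2 x≤))) ⟩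
    disc w s * (m * m) + 2 * ((w + 2) * m) * (d * m) + d * m * (d * m) ≡⟨ disc-shift w s d m ⟨
    disc (w + d) (s + d) * (m * m)                                     ∎
    where
      x≤ : x ≤ (w + 2) * m
      x≤ = m*m≤n*n⇒m≤n (begin
        x * x                         ≤⟨ xx≤ ⟩
        disc w s * (m * m)            ≤⟨ *-monoˡ-≤ (m * m) (disc-≤-square s≤1+w) ⟩
        (w + 2) * (w + 2) * (m * m)   ≡⟨ solve 2 (λ u m → u :* u :* (m :* m) := u :* m :* (u :* m)) refl (w + 2) m ⟩
        (w + 2) * m * ((w + 2) * m)   ∎)

  -- For s ≤ w, N = (w + 2)(w + 3) is large enough that √disc w s + d + 1/N ≤ √disc (w + d) (s + d).
  disc-shift-< : ∀ {w s} d {e} → s ≤ w → 1 ≤ d →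
                 let N = (w + 2) * (w + 3) in
                 e * e ≤ disc w s * (N * N) →
                 (d * N + suc e) * (d * N + suc e) ≤ disc (w + d) (s + d) * (N * N)
  disc-shift-< {w} {s} d {e} s≤w 1≤d ee≤ = begin
    (d * N + suc e) * (d * N + suc e)
      ≡⟨ solve 2 (λ e dN → (dN :+ (con 1 :+ e)) :* (dN :+ (con 1 :+ e))
                             := e :* e :+ (con 2 :* (con 1 :+ e) :* dN :+ (con 2 :* e :+ con 1)) :+ dN :* dN)
                 refl e (d * N) ⟩
    e * e + (2 * suc e * (d * N) + (2 * e + 1)) + d * N * (d * N)
      ≤⟨ +-monoˡ-≤ (d * N * (d * N)) (+-mono-≤ ee≤ (+-mono-≤ (*-monoˡ-≤ (d * N) (*-monoʳ-≤ 2 (s≤s e≤M))) 2e+1≤)) ⟩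
    disc w s * (N * N) + (2 * suc M * (d * N) + 2 * (w + 2) * (d * N)) + d * N * (d * N)
      ≡⟨ cong (λ t → disc w s * (N * N) + t + d * N * (d * N)) merge ⟩
    disc w s * (N * N) + 2 * ((w + 2) * N) * (d * N) + d * N * (d * N)
      ≡⟨ disc-shift w s d N ⟨
    disc (w + d) (s + d) * (N * N)
      ∎
    where
      N : ℕ
      N = (w + 2) * (w + 3)
      M : ℕ
      M = (w + 3) * (w + 3) * (w + 1)
      1+M+[w+2] : suc M + (w + 2) ≡ (w + 2) * N
      1+M+[w+2] = solve 1 (λ w → con 1 :+ (w :+ con 3) :* (w :+ con 3) :* (w :+ con 1) :+ (w :+ con 2)
                                   := (w :+ con 2) :* ((w :+ con 2) :* (w :+ con 3))) refl w
      merge : 2 * suc M * (d * N) + 2 * (w + 2) * (d * N) ≡ 2 * ((w + 2) * N) * (d * N)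
      merge = trans (solve 3 (λ M w x → con 2 :* M :* x :+ con 2 :* w :* x := con 2 :* (M :+ w) :* x) refl (suc M) (w + 2) (d * N))
                    (cong (λ t → 2 * t * (d * N)) 1+M+[w+2])
      e≤M : e ≤ M
      e≤M = m*m≤n*n⇒m≤n (begin
        e * e                       ≤⟨ ee≤ ⟩
        disc w s * (N * N)          ≤⟨ *-monoˡ-≤ (N * N) (+-monoʳ-≤ (w * w) (*-monoʳ-≤ 4 s≤w)) ⟩
        disc w w * (N * N)          ≤⟨ m≤m+n _ _ ⟩
        disc w w * (N * N) + (w + 3) * (w + 3) * (2 * (w + 2) * (w + 2) + 1)
          ≡⟨ solve 1 (λ w → (w :* w :+ con 4 :* w) :* (((w :+ con 2) :* (w :+ con 3)) :* ((w :+ con 2) :* (w :+ con 3)))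
                             :+ (w :+ con 3) :* (w :+ con 3) :* (con 2 :* (w :+ con 2) :* (w :+ con 2) :+ con 1)
                             := (w :+ con 3) :* (w :+ con 3) :* (w :+ con 1) :* ((w :+ con 3) :* (w :+ con 3) :* (w :+ con 1)))
                     refl w ⟩
        M * M                       ∎)
      2e+1≤ : 2 * e + 1 ≤ 2 * (w + 2) * (d * N)
      2e+1≤ = begin
        2 * e + 1                   ≤⟨ +-monoʳ-≤ (2 * e) (s≤s (z≤n {1})) ⟩
        2 * e + 2                   ≡⟨ solve 1 (λ e → con 2 :* e :+ con 2 := con 2 :* (con 1 :+ e)) refl e ⟩
        2 * suc e
          ≤⟨ *-monoʳ-≤ 2 (≤-trans (s≤s e≤M) (≤-trans (m≤m+n (suc M) (w + 2)) (≤-reflexive 1+M+[w+2]))) ⟩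
        2 * ((w + 2) * N)           ≤⟨ *-monoʳ-≤ 2 (*-monoʳ-≤ (w + 2) (m≤n*m N d ⦃ >-nonZero 1≤d ⦄)) ⟩
        2 * ((w + 2) * (d * N))     ≡⟨ *-assoc 2 (w + 2) (d * N) ⟨
        2 * (w + 2) * (d * N)       ∎

surd-shift-≤ℝ : ∀ {b d D E} →
                (∀ R m → ⟨ R / m ⟩≤√ D → ⟨ R ℤ.+ + (d * m) / m ⟩≤√ E) →
                surd (b ℤ.+ + d) D ≤ℝ surd b E
surd-shift-≤ℝ {b} {d} {D} {E} h = ≤ℝ-intro {b ℤ.+ + d} {D} {b} {E} λ i m R≤ →
  subst (λ z → ⟨ z / m ⟩≤√ E) (shift i m) (h _ m R≤)
  where
    open ℤ-Solver.+-*-Solver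
    shift : ∀ i m → + 2 ℤ.* i ℤ.- (b ℤ.+ + d) ℤ.* + m ℤ.+ + (d * m) ≡ + 2 ℤ.* i ℤ.- b ℤ.* + m
    shift i m = trans (cong (λ z → + 2 ℤ.* i ℤ.- (b ℤ.+ + d) ℤ.* + m ℤ.+ z) (ℤ.pos-* d m))
      (solve 4 (λ i b d m → con (+ 2) :* i :- (b :+ d) :* m :+ d :* m := con (+ 2) :* i :- b :* m) refl i b (+ d) (+ m))

surd-square-≤ℝ : ∀ {a t b u} → a ℤ.+ + t ≡ b ℤ.+ + u → surd a (t * t) ≤ℝ surd b (u * u)
surd-square-≤ℝ {a} {t} {b} {u} a+t≡b+u = ≤ℝ-intro {a} {t * t} {b} {u * u} λ i m R≤ →
  Equivalence.from (≤√-square⇔ _ m u)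
    (subst₂ ℤ._≤_ (moved i m) (moved⁺ m) (ℤ.+-monoˡ-≤ ((+ u ℤ.- + t) ℤ.* + m) (Equivalence.to (≤√-square⇔ _ m t) R≤)))
  where
    open ℤ-Solver.+-*-Solver
    b≡ : b ≡ a ℤ.+ + t ℤ.- + u
    b≡ = sym (trans (cong (ℤ._- + u) a+t≡b+u) (solve 2 (λ b u → b :+ u :- u := b) refl b (+ u)))
    moved : ∀ i m → + 2 ℤ.* i ℤ.- a ℤ.* + m ℤ.+ (+ u ℤ.- + t) ℤ.* + m ≡ + 2 ℤ.* i ℤ.- b ℤ.* + m
    moved i m rewrite b≡ =
      solve 5 (λ i a t u m → con (+ 2) :* i :- a :* m :+ (u :- t) :* m := con (+ 2) :* i :- (a :+ t :- u) :* m)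
            refl i a (+ t) (+ u) (+ m)
    moved⁺ : ∀ m → + (t * m) ℤ.+ (+ u ℤ.- + t) ℤ.* + m ≡ + (u * m)
    moved⁺ m rewrite ℤ.pos-* t m | ℤ.pos-* u m = solve 3 (λ t u m → t :* m :+ (u :- t) :* m := u :* m) refl (+ t) (+ u) (+ m)

surd-square-≈ℝ : ∀ {a t b u} → a ℤ.+ + t ≡ b ℤ.+ + u → surd a (t * t) ≈ℝ surd b (u * u)
surd-square-≈ℝ {a} {t} {b} {u} eq = surd-square-≤ℝ {a} {t} {b} {u} eq , surd-square-≤ℝ {b} {u} {a} {t} (sym eq)


double-square-≤ : ∀ x N D → (2 * x) * (2 * x) ≤ D * ((2 * N) * (2 * N)) ⇔ x * x ≤ D * (N * N)
double-square-≤ x N D = mk⇔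
  (λ h → *-cancelˡ-≤ 4 (subst₂ _≤_ (four x) (four′ N) h))
  (λ h → subst₂ _≤_ (sym (four x)) (sym (four′ N)) (*-monoʳ-≤ 4 h))
  where
    open +-*-Solver
    four : ∀ x → (2 * x) * (2 * x) ≡ 4 * (x * x)
    four = solve 1 (λ x → (con 2 :* x) :* (con 2 :* x) := con 4 :* (x :* x)) refl
    four′ : ∀ N → D * ((2 * N) * (2 * N)) ≡ 4 * (D * (N * N))
    four′ = solve 2 (λ D N → D :* ((con 2 :* N) :* (con 2 :* N)) := con 4 :* (D :* (N :* N))) refl D

-- Test the order at the rational (b + (dN + e)/N)/2, written with denominator 2N.
surd-shift-≥ℝ⇒ : ∀ {b d D E} → surd b E ≤ℝ surd (b ℤ.+ + d) D →
                 ∀ N e .{{_ : NonZero N}} →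
                 (d * N + e) * (d * N + e) ≤ E * (N * N) → e * e ≤ D * (N * N)
surd-shift-≥ℝ⇒ {b} {d} {D} {E} h N e ⦃ N≢0 ⦄ xx≤ =
  Equivalence.to (double-square-≤ e N D)
    (Equivalence.to (≤√-pos⇔ (2 * e) (2 * N) D)
      (subst (λ z → ⟨ z / 2 * N ⟩≤√ D) shifted
        (Equivalence.to (≤val⇔≤√ (b ℤ.+ + d) D i (2 * N)) (h (i ℚ./ (2 * N)) q≤E))))
  where
    instance _ = m*n≢0 2 N
    open ℤ-Solver.+-*-Solver
    open ≡-Reasoning
    x : ℕ
    x = d * N + e
    i : ℤ
    i = + x ℤ.+ b ℤ.* + N
    unshifted : + 2 ℤ.* i ℤ.- b ℤ.* + (2 * N) ≡ + (2 * x)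
    unshifted = begin
      + 2 ℤ.* i ℤ.- b ℤ.* + (2 * N)      ≡⟨ cong (λ z → + 2 ℤ.* i ℤ.- b ℤ.* z) (ℤ.pos-* 2 N) ⟩
      + 2 ℤ.* i ℤ.- b ℤ.* (+ 2 ℤ.* + N)
        ≡⟨ solve 3 (λ x b N → con (+ 2) :* (x :+ b :* N) :- b :* (con (+ 2) :* N) := con (+ 2) :* x) refl (+ x) b (+ N) ⟩
      + 2 ℤ.* + x                        ≡⟨ ℤ.pos-* 2 x ⟨
      + (2 * x)                          ∎
    shifted : + 2 ℤ.* i ℤ.- (b ℤ.+ + d) ℤ.* + (2 * N) ≡ + (2 * e)
    shifted = begin
      + 2 ℤ.* i ℤ.- (b ℤ.+ + d) ℤ.* + (2 * N)
        ≡⟨ cong₂ (λ y z → + 2 ℤ.* (y ℤ.+ b ℤ.* + N) ℤ.- (b ℤ.+ + d) ℤ.* z)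
                 (trans (ℤ.pos-+ (d * N) e) (cong (ℤ._+ + e) (ℤ.pos-* d N))) (ℤ.pos-* 2 N) ⟩
      + 2 ℤ.* ((+ d ℤ.* + N ℤ.+ + e) ℤ.+ b ℤ.* + N) ℤ.- (b ℤ.+ + d) ℤ.* (+ 2 ℤ.* + N)
        ≡⟨ solve 4 (λ d N e b → con (+ 2) :* ((d :* N :+ e) :+ b :* N) :- (b :+ d) :* (con (+ 2) :* N)
                                 := con (+ 2) :* e)
                   refl (+ d) (+ N) (+ e) b ⟩
      + 2 ℤ.* + e                        ≡⟨ ℤ.pos-* 2 e ⟨
      + (2 * e)                          ∎
    q≤E : (i ℚ./ (2 * N)) ≤val surd b E
    q≤E = Equivalence.from (≤val⇔≤√ b E i (2 * N))
            (subst (λ z → ⟨ z / 2 * N ⟩≤√ E) (sym unshifted)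
              (Equivalence.from (≤√-pos⇔ (2 * x) (2 * N) E) (Equivalence.from (double-square-≤ x N E) xx≤)))

-- Otherwise disc-shift-< and surd-shift-≥ℝ⇒ would put every (dN + e)/N below √disc (w + d) (s + d).
disc-surd-≱ℝ : ∀ {b w s d} → s ≤ w → 1 ≤ d →
               ¬ (surd b (disc (w + d) (s + d)) ≤ℝ surd (b ℤ.+ + d) (disc w s))
disc-surd-≱ℝ {b} {w} {s} {d} s≤w 1≤d h = <⇒≱ (≤-trans (m≤m*n (suc X) (suc X)) (*-mono-≤ bound bound)) (below (suc X))
  where
    N : ℕ
    N = (w + 2) * (w + 3)
    instance _ = m*n≢0 (w + 2) (w + 3) ⦃ ≢-nonZero (m+1+n≢0 w) ⦄ ⦃ ≢-nonZero (m+1+n≢0 w) ⦄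
    X : ℕ
    X = disc (w + d) (s + d) * (N * N)
    bound : suc X ≤ d * N + suc X
    bound = m≤n+m (suc X) (d * N)
    below : ∀ e → (d * N + e) * (d * N + e) ≤ X
    below zero = subst (λ z → z * z ≤ X) (sym (+-identityʳ (d * N))) (disc-shift-≤ d N {0} (m≤n⇒m≤1+n s≤w) z≤n)
    below (suc e) = disc-shift-< d s≤w 1≤d (surd-shift-≥ℝ⇒ {b} {d} {disc w s} {disc (w + d) (s + d)} h N e (below e))

pos[m+n]-1 : ∀ m n → + (m + n) ℤ.- + 1 ≡ (+ m ℤ.- + 1) ℤ.+ + n
pos[m+n]-1 m n = trans (cong (ℤ._- + 1) (ℤ.pos-+ m n))
  (solve 2 (λ x y → (x :+ y) :- con (+ 1) := (x :- con (+ 1)) :+ y) refl (+ m) (+ n))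
  where open ℤ-Solver.+-*-Solver

φ′ : ℕ → ℕ → ℕ → Surd
φ′ c v s = let t = + (2 * c) ℤ.- + (v + 1) in surd (+ v ℤ.- + 1) (ℤ.∣ t ∣ * ℤ.∣ t ∣ + 4 * s)

φ′-as-surd : ∀ {c v w} s → v + 1 + w ≡ 2 * c → φ′ c v s ≡ surd (+ v ℤ.- + 1) (disc w s)
φ′-as-surd {c} {v} {w} s eq = cong (λ t → surd (+ v ℤ.- + 1) (t * t + 4 * s)) ∣t∣≡w
  where
    open ℤ-Solver.+-*-Solver
    ∣t∣≡w : ℤ.∣ + (2 * c) ℤ.- + (v + 1) ∣ ≡ w
    ∣t∣≡w = cong ℤ.∣_∣ (begin
      + (2 * c) ℤ.- + (v + 1)          ≡⟨ cong (λ z → + z ℤ.- + (v + 1)) eq ⟨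
      + (v + 1 + w) ℤ.- + (v + 1)      ≡⟨ cong (ℤ._- + (v + 1)) (ℤ.pos-+ (v + 1) w) ⟩
      + (v + 1) ℤ.+ + w ℤ.- + (v + 1)  ≡⟨ solve 2 (λ a w → a :+ w :- a := w) refl (+ (v + 1)) (+ w) ⟩
      + w                              ∎)
      where open ≡-Reasoning

disc-surd-≤ℝ : ∀ b {w s} d → s ≤ suc w → surd (b ℤ.+ + d) (disc w s) ≤ℝ surd b (disc (w + d) (s + d))
disc-surd-≤ℝ b {w} {s} d s≤1+w = surd-shift-≤ℝ {b} {d} {disc w s} {disc (w + d) (s + d)} shift
  where
    shift : ∀ R m → ⟨ R / m ⟩≤√ disc w s → ⟨ R ℤ.+ + (d * m) / m ⟩≤√ disc (w + d) (s + d)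
    shift (+ x) m cut = ≤√-bound (ℤ.≤-reflexive (sym (ℤ.pos-+ x (d * m))))
                                 (disc-shift-≤ d m {x} s≤1+w (Equivalence.to (≤√-pos⇔ x m (disc w s)) cut))
    shift -[1+ r ] m _ = ≤√-bound (ℤ.+-monoˡ-≤ (+ (d * m)) (-≤+ {r} {0}))
                                 (disc-shift-≤ d m {0} s≤1+w z≤n)

disc-surd-≈ℝ : ∀ b w d → surd (b ℤ.+ + d) (disc w (suc w)) ≈ℝ surd b (disc (w + d) (suc w + d))
disc-surd-≈ℝ b w d = subst₂ (λ D E → surd (b ℤ.+ + d) D ≈ℝ surd b E) (sym (square w)) (sym (square (w + d)))
  (surd-square-≈ℝ {b ℤ.+ + d} {w + 2} {b} {w + d + 2} (begin
    b ℤ.+ + d ℤ.+ + (w + 2)  ≡⟨ ℤ.+-assoc b (+ d) (+ (w + 2)) ⟩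
    b ℤ.+ + (d + (w + 2))    ≡⟨ cong (λ z → b ℤ.+ + z) (solve 2 (λ d w → d :+ (w :+ con 2) := w :+ d :+ con 2) refl d w) ⟩
    b ℤ.+ + (w + d + 2)      ∎))
  where
    open +-*-Solver
    open ≡-Reasoning
    square : ∀ w → disc w (suc w) ≡ (w + 2) * (w + 2)
    square = solve 1 (λ w → w :* w :+ con 4 :* (con 1 :+ w) := (w :+ con 2) :* (w :+ con 2)) refl

φ′-trade : ∀ {c v s v′ s′} → 1 ≤ s → s + v ≤ 2 * c → v′ < v → s′ + v′ ≡ s + v →
           φ′ c v s ≤ℝ φ′ c v′ s′ × (φ′ c v s ≈ℝ φ′ c v′ s′ ⇔ v + s ≡ 2 * c)
φ′-trade {c} {v} {s} {v′} {s′} 1≤s s+v≤2c v′<v s′+v′≡s+v =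
  subst₂ (λ x y → x ≤ℝ y × (x ≈ℝ y ⇔ v + s ≡ 2 * c)) (sym φ≡) (sym φ′≡)
    (disc-surd-≤ℝ b d s≤1+w , mk⇔ equal⇒ ⇒equal)
  where
    open +-*-Solver
    d : ℕ
    d = v ∸ v′
    w : ℕ
    w = 2 * c ∸ (v + 1)
    b : ℤ
    b = + v′ ℤ.- + 1
    v′+d≡v : v′ + d ≡ v
    v′+d≡v = m+[n∸m]≡n (<⇒≤ v′<v)
    v+1+w≡2c : v + 1 + w ≡ 2 * c
    v+1+w≡2c = m+[n∸m]≡n (≤-trans (+-monoʳ-≤ v 1≤s) (≤-trans (≤-reflexive (+-comm v s)) s+v≤2c))
    v+[1+w]≡2c : v + suc w ≡ 2 * c
    v+[1+w]≡2c = trans (solve 2 (λ v w → v :+ (con 1 :+ w) := v :+ con 1 :+ w) refl v w) v+1+w≡2c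
    s≤1+w : s ≤ suc w
    s≤1+w = +-cancelˡ-≤ v s (suc w) (≤-trans (≤-reflexive (+-comm v s)) (≤-trans s+v≤2c (≤-reflexive (sym v+[1+w]≡2c))))
    φ≡ : φ′ c v s ≡ surd (b ℤ.+ + d) (disc w s)
    φ≡ = trans (φ′-as-surd {c} {v} {w} s v+1+w≡2c)
               (cong (λ a → surd a (disc w s)) (trans (cong (λ z → + z ℤ.- + 1) (sym v′+d≡v)) (pos[m+n]-1 v′ d)))
    s′≡s+d : s′ ≡ s + d
    s′≡s+d = +-cancelʳ-≡ v′ s′ (s + d) (trans s′+v′≡s+v (trans (cong (λ z → s + z) (sym v′+d≡v))
               (solve 3 (λ s v′ d → s :+ (v′ :+ d) := s :+ d :+ v′) refl s v′ d)))
    φ′≡ : φ′ c v′ s′ ≡ surd b (disc (w + d) (s + d))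
    φ′≡ = trans (φ′-as-surd {c} {v′} {w + d} s′
                  (trans (solve 3 (λ v′ w d → v′ :+ con 1 :+ (w :+ d) := v′ :+ d :+ con 1 :+ w) refl v′ w d)
                                      (trans (cong (λ z → z + 1 + w) v′+d≡v) v+1+w≡2c)))
                (cong (λ z → surd b (disc (w + d) z)) s′≡s+d)
    1≤d : 1 ≤ d
    1≤d = m<n⇒0<n∸m v′<v
    equal⇒ : surd (b ℤ.+ + d) (disc w s) ≈ℝ surd b (disc (w + d) (s + d)) → v + s ≡ 2 * c
    equal⇒ (_ , ≥) with m≤n⇒m<n∨m≡n s≤1+w
    ... | inj₁ (s≤s s≤w) = ⊥-elim (disc-surd-≱ℝ {b} s≤w 1≤d ≥)
    ... | inj₂ refl = v+[1+w]≡2c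
    ⇒equal : v + s ≡ 2 * c → surd (b ℤ.+ + d) (disc w s) ≈ℝ surd b (disc (w + d) (s + d))
    ⇒equal v+s≡2c with +-cancelˡ-≡ v s (suc w) (trans v+s≡2c (sym v+[1+w]≡2c))
    ... | refl = disc-surd-≈ℝ b w d

-- Counting ones

count : ∀ {n} → (Fin n → Bool) → ℕ
count {zero}  f = 0
count {suc n} f = b2n (f zero) + count (f ∘ suc)

rowSum≡count : ∀ {n} (M : Mat n) i → rowSum M i ≡ count (M i)
rowSum≡count {n} M i = trans (cong sum (map-tabulate (λ j → j) (b2n ∘ M i))) (sum-tabulate (M i))
  where
    sum-tabulate : ∀ {m} (f : Fin m → Bool) → sum (tabulate (b2n ∘ f)) ≡ count f
    sum-tabulate {zero}  f = refl
    sum-tabulate {suc m} f = cong (_+_ (b2n (f zero))) (sum-tabulate (f ∘ suc))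

count-cong : ∀ {n} {f g : Fin n → Bool} → (∀ j → f j ≡ g j) → count f ≡ count g
count-cong {zero}  f≗g = refl
count-cong {suc n} f≗g = cong₂ _+_ (cong b2n (f≗g zero)) (count-cong (f≗g ∘ suc))

b2n≤1 : ∀ b → b2n b ≤ 1
b2n≤1 true  = ≤-refl
b2n≤1 false = z≤n

count≤n : ∀ {n} (f : Fin n → Bool) → count f ≤ n
count≤n {zero}  f = z≤n
count≤n {suc n} f = +-mono-≤ (b2n≤1 (f zero)) (count≤n (f ∘ suc))

count-const : ∀ n b → count {n} (const b) ≡ n * b2n b
count-const zero    b = refl
count-const (suc n) b = cong (_+_ (b2n b)) (count-const n b)

count-updateAt : ∀ {n} (f : Fin n → Bool) y b →
                 count (updateAt f y (const b)) + b2n (f y) ≡ count f + b2n b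
count-updateAt {suc n} f zero b =
  solve 3 (λ a b c → (b :+ c) :+ a := (a :+ c) :+ b) refl (b2n (f zero)) (b2n b) (count (f ∘ suc))
  where open +-*-Solver
count-updateAt {suc n} f (suc y) b = begin
  b2n (f zero) + count (updateAt (f ∘ suc) y (const b)) + b2n (f (suc y))
    ≡⟨ +-assoc (b2n (f zero)) _ _ ⟩
  b2n (f zero) + (count (updateAt (f ∘ suc) y (const b)) + b2n (f (suc y)))
    ≡⟨ cong (_+_ (b2n (f zero))) (count-updateAt (f ∘ suc) y b) ⟩
  b2n (f zero) + (count (f ∘ suc) + b2n b)
    ≡⟨ +-assoc (b2n (f zero)) _ _ ⟨
  count f + b2n b ∎
  where open ≡-Reasoning

b2n-mono : ∀ {a b} → (a ≡ true → b ≡ true) → b2n a ≤ b2n b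
b2n-mono {false} _   = z≤n
b2n-mono {true}  a⇒b rewrite a⇒b refl = ≤-refl

count-mono : ∀ {n} {f g : Fin n → Bool} → (∀ j → f j ≡ true → g j ≡ true) → count f ≤ count g
count-mono {zero}  f⇒g = z≤n
count-mono {suc n} f⇒g = +-mono-≤ (b2n-mono (f⇒g zero)) (count-mono (f⇒g ∘ suc))

count-complement : ∀ {n} (f : Fin n → Bool) → count f + count (not ∘ f) ≡ n
count-complement {zero}  f = refl
count-complement {suc n} f with f zero
... | true  = cong suc (count-complement (f ∘ suc))
... | false = trans (+-suc (count (f ∘ suc)) _) (cong suc (count-complement (f ∘ suc)))

0<count⇒∃ : ∀ {n} (f : Fin n → Bool) → 0 < count f → ∃ λ j → f j ≡ true
0<count⇒∃ {suc n} f 0<count with f zero in f0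
... | true  = zero , f0
... | false = let j , fj = 0<count⇒∃ (f ∘ suc) 0<count in suc j , fj

count-set-false : ∀ {n} (f : Fin n → Bool) {y} → f y ≡ true →
                  count (updateAt f y (const false)) + 1 ≡ count f
count-set-false f {y} fy = trans (cong (λ b → count (updateAt f y (const false)) + b2n b) (sym fy))
                                 (trans (count-updateAt f y false) (+-identityʳ _))

count-set-true : ∀ {n} (f : Fin n → Bool) {y} → f y ≡ false →
                 count (updateAt f y (const true)) ≡ count f + 1
count-set-true f {y} fy = trans (sym (+-identityʳ _))
  (trans (cong (λ b → count (updateAt f y (const true)) + b2n b) (sym fy)) (count-updateAt f y true))

count<n : ∀ {n} (f : Fin n → Bool) {y} → f y ≡ false → suc (count f) ≤ n
count<n {n} f fy = subst (_≤ n) (trans (count-set-true f fy) (+-comm _ 1)) (count≤n _)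

true⇒0<count : ∀ {n} (f : Fin n → Bool) {y} → f y ≡ true → 1 ≤ count f
true⇒0<count f fy = subst (1 ≤_) (count-set-false f fy) (m≤n+m 1 _)

count≤-support : ∀ {n} m (f : Fin n → Bool) → (∀ j → f j ≡ true → toℕ j < m) → count f ≤ m
count≤-support {zero}  m       f bound = z≤n
count≤-support {suc n} zero    f bound with f zero in f0
... | true  = contradiction (bound zero f0) λ ()
... | false = count≤-support zero (f ∘ suc) (λ j fj → contradiction (bound (suc j) fj) λ ())
count≤-support {suc n} (suc m) f bound =
  +-mono-≤ (b2n≤1 (f zero)) (count≤-support m (f ∘ suc) (λ j fj → ≤-pred (bound (suc j) fj)))

count≥-tail : ∀ {n} m (f : Fin n → Bool) → (∀ j → m ≤ toℕ j → f j ≡ true) → n ∸ m ≤ count f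
count≥-tail {zero}  m       f full = ≤-reflexive (0∸n≡0 m)
count≥-tail {suc n} zero    f full = subst (_≤ count f) (trans (count-const (suc n) true) (*-identityʳ _))
                                       (count-mono {f = const true} (λ j _ → full j z≤n))
count≥-tail {suc n} (suc m) f full =
  ≤-trans (count≥-tail m (f ∘ suc) (λ j m≤j → full (suc j) (s≤s m≤j))) (m≤n+m _ _)

count-almost-full : ∀ {n} (f : Fin n → Bool) y → (∀ j → j ≢ y → f j ≡ true) → n ≤ suc (count f)
count-almost-full {n} f y full = begin
  n                                           ≡⟨ trans (sym (*-identityʳ n)) (sym (count-const n true)) ⟩
  count {n} (const true)                      ≤⟨ count-mono {g = updateAt f y (const true)} everywhere ⟩
  count (updateAt f y (const true))           ≤⟨ m≤m+n _ (b2n (f y)) ⟩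
  count (updateAt f y (const true)) + b2n (f y) ≡⟨ count-updateAt f y true ⟩
  count f + 1                                 ≡⟨ +-comm _ 1 ⟩
  suc (count f)                               ∎
  where
    open ≤-Reasoning
    everywhere : ∀ j → true ≡ true → updateAt f y (const true) j ≡ true
    everywhere j _ with j ≟ y
    ... | yes refl = updateAt-updates y f
    ... | no j≢y   = trans (updateAt-minimal j y f j≢y) (full j j≢y)

count-at-most-one : ∀ {n} (f : Fin n → Bool) y → (∀ j → f j ≡ true → j ≡ y) → count f ≤ 1
count-at-most-one {n} f y only-y = begin
  count f                                             ≡⟨ +-identityʳ _ ⟨
  count f + b2n false                                 ≡⟨ count-updateAt f y false ⟨
  count (updateAt f y (const false)) + b2n (f y)
    ≡⟨ cong (_+ b2n (f y)) (trans (count-cong nowhere) (trans (count-const n false) (*-zeroʳ n))) ⟩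
  b2n (f y)                                           ≤⟨ b2n≤1 (f y) ⟩
  1                                                   ∎
  where
    open ≤-Reasoning
    nowhere : ∀ j → updateAt f y (const false) j ≡ false
    nowhere j with j ≟ y | f j in fj
    ... | yes refl | _     = updateAt-updates y f
    ... | no j≢y   | false = trans (updateAt-minimal j y f j≢y) fj
    ... | no j≢y   | true  = contradiction (only-y j fj) j≢y

count-unique : ∀ {n} (f : Fin n → Bool) → (∀ j k → f j ≡ true → f k ≡ true → j ≡ k) → count f ≤ 1
count-unique f unique with count f in eq
... | zero  = z≤n
... | suc m = let j , fj = 0<count⇒∃ f (subst (0 <_) (sym eq) z<s) in
              subst (_≤ 1) eq (count-at-most-one f j (λ k fk → unique k j fk fj))

count≥-tail+point : ∀ {n} m (f : Fin n → Bool) y → (∀ j → m ≤ toℕ j → f j ≡ true) →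
                   f y ≡ true → toℕ y < m → suc (n ∸ m) ≤ count f
count≥-tail+point {n} m f y full fy y<m = begin
  suc (n ∸ m)                              ≡⟨ +-comm 1 (n ∸ m) ⟩
  n ∸ m + 1
    ≤⟨ +-monoˡ-≤ 1 (count≥-tail m g (λ j m≤j → trans (updateAt-minimal j y f (j≢y m≤j)) (full j m≤j))) ⟩
  count g + 1                              ≡⟨ count-set-false f fy ⟩
  count f                                  ∎
  where
    open ≤-Reasoning
    g : Fin n → Bool
    g = updateAt f y (const false)
    j≢y : ∀ {j} → m ≤ toℕ j → j ≢ y
    j≢y m≤j refl = <⇒≱ y<m m≤j

-- Least and greatest elements of decidable subsets of Fin n

least : ∀ {n p} (P : Pred (Fin n) p) → Decidable P → ∃ P →
        ∃ λ i → P i × (∀ k → toℕ k < toℕ i → ¬ P k)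
least {n} P P? (w , Pw) with ¬∀⟶∃¬-smallest n (¬_ ∘ P) (¬? ∘ P?) (λ ∀¬P → ∀¬P w Pw)
... | i , ¬¬Pi , below = i , decidable-stable (P? i) ¬¬Pi , before
  where
    before : ∀ k → toℕ k < toℕ i → ¬ P k
    before k k<i = subst (¬_ ∘ P) (toℕ-injective (trans (toℕ-inject j) (toℕ-fromℕ< k<i))) (below j)
      where
        j : Fin (toℕ i)
        j = fromℕ< k<i

opposite-< : ∀ {n} {i k : Fin n} → toℕ i < toℕ k → toℕ (opposite k) < toℕ (opposite i)
opposite-< {n} {i} {k} i<k = subst₂ _<_ (sym (opposite-prop k)) (sym (opposite-prop i))
  (∸-monoʳ-< (s≤s i<k) (toℕ<n k))

greatest : ∀ {n p} (P : Pred (Fin n) p) → Decidable P → ∃ P →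
           ∃ λ i → P i × (∀ k → toℕ i < toℕ k → ¬ P k)
greatest {n} P P? (w , Pw) with least (P ∘ opposite) (P? ∘ opposite) (opposite w , subst P (sym (opposite-involutive w)) Pw)
... | i , Pi′ , before = opposite i , Pi′ , after
  where
    after : ∀ k → toℕ (opposite i) < toℕ k → ¬ P k
    after k i′<k Pk = before (opposite k) (subst (λ x → toℕ (opposite k) < toℕ x) (opposite-involutive i) (opposite-< i′<k))
                               (subst P (sym (opposite-involutive k)) Pk)

-- maxSat, rows and prefix sums

maxSat-≤ : ∀ p k → maxSat p k ≤ k
maxSat-≤ p zero = z≤n
maxSat-≤ p (suc k) with p (suc k)
... | true  = ≤-refl
... | false = m≤n⇒m≤1+n (maxSat-≤ p k)

maxSat-true : ∀ p k → 0 < maxSat p k → p (maxSat p k) ≡ true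
maxSat-true p (suc k) 0<max with p (suc k) in pk
... | true  = pk
... | false = maxSat-true p k 0<max

maxSat-false : ∀ p k {i} → maxSat p k < i → i ≤ k → p i ≡ false
maxSat-false p zero    max<i i≤0 = contradiction i≤0 (<⇒≱ max<i)
maxSat-false p (suc k) {i} max<i i≤k with p (suc k) in pk
... | true  = contradiction i≤k (<⇒≱ max<i)
... | false with m≤n⇒m<n∨m≡n i≤k
...   | inj₁ i<k    = maxSat-false p k max<i (≤-pred i<k)
...   | inj₂ refl   = pk

maxSat-≥ : ∀ p k {m} → p m ≡ true → m ≤ k → m ≤ maxSat p k
maxSat-≥ p zero    pm m≤k = m≤k
maxSat-≥ p (suc k) {m} pm m≤k with p (suc k) in pk
... | true  = m≤k
... | false with m≤n⇒m<n∨m≡n m≤k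
...   | inj₁ m<k  = maxSat-≥ p k pm (≤-pred m<k)
...   | inj₂ refl = contradiction (trans (sym pm) pk) λ ()

maxSat-≤-bound : ∀ p k m → (∀ i → m < i → i ≤ k → p i ≡ false) → maxSat p k ≤ m
maxSat-≤-bound p k m above with maxSat p k ≤? m
... | yes max≤m = max≤m
... | no  max≰m = contradiction (maxSat-true p k (≤-<-trans z≤n (≰⇒> max≰m)))
                    (λ pmax → contradiction (trans (sym pmax) (above _ (≰⇒> max≰m) (maxSat-≤ p k))) λ ())

maxSat-stable : ∀ p q k → (p (maxSat p k) ≡ true → q (maxSat p k) ≡ true) →
                (∀ i → maxSat p k < i → i ≤ k → q i ≡ p i) → maxSat q k ≡ maxSat p k
maxSat-stable p q zero    _       _     = refl
maxSat-stable p q (suc k) at-max above with p (suc k) in pk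
... | true  rewrite at-max pk = refl
... | false rewrite above (suc k) (s≤s (maxSat-≤ p k)) ≤-refl | pk =
  maxSat-stable p q k at-max (λ i max<i i≤k → above i max<i (m≤n⇒m≤1+n i≤k))


row-toℕ : ∀ {n} (M : Mat n) i → row M (toℕ i) ≡ count (M i)
row-toℕ {n} M i with toℕ i <? n
... | yes i<n = trans (cong (rowSum M) (fromℕ<-toℕ i i<n)) (rowSum≡count M i)
... | no  i≮n = contradiction (toℕ<n i) i≮n

row-≥ : ∀ {n} (M : Mat n) {t} → n ≤ t → row M t ≡ 0
row-≥ {n} M {t} n≤t with t <? n
... | yes t<n = contradiction n≤t (<⇒≱ t<n)
... | no  _   = refl

row-index : ∀ {n} (M : Mat n) {t} → 0 < row M t → t < n
row-index {n} M {t} 0<row with t <? n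
... | yes t<n = t<n
... | no  _   = contradiction 0<row λ ()

prefix-≥ : ∀ {n} (M : Mat n) k m → (∀ t → t < k → m ≤ row M t) → k * m ≤ prefix M k
prefix-≥ M zero    m rows = z≤n
prefix-≥ M (suc k) m rows = subst (_≤ prefix M (suc k)) (+-comm (k * m) m)
  (+-mono-≤ (prefix-≥ M k m (λ t t<k → rows t (m<n⇒m<1+n t<k))) (rows k ≤-refl))

prefix-≤ : ∀ {n} (M : Mat n) k m → (∀ t → row M t ≤ m) → prefix M k ≤ k * m
prefix-≤ M zero    m rows = z≤n
prefix-≤ M (suc k) m rows = subst (prefix M (suc k) ≤_) (+-comm (k * m) m)
  (+-mono-≤ (prefix-≤ M k m rows) (rows k))

δ : ℕ → ℕ → ℕ
δ a t = b2n (a ≡ᵇ t)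

δ-refl : ∀ a → δ a a ≡ 1
δ-refl zero    = refl
δ-refl (suc a) = δ-refl a

δ-≢ : ∀ {a t} → a ≢ t → δ a t ≡ 0
δ-≢ {zero}  {zero}  a≢t = contradiction refl a≢t
δ-≢ {zero}  {suc t} a≢t = refl
δ-≢ {suc a} {zero}  a≢t = refl
δ-≢ {suc a} {suc t} a≢t = δ-≢ (a≢t ∘ cong suc)

-- The indicator of a < k, written as a sum so that it unfolds in step with prefix.
δ< : ℕ → ℕ → ℕ
δ< a zero    = 0
δ< a (suc k) = δ< a k + δ a k

δ<-≥ : ∀ {a k} → k ≤ a → δ< a k ≡ 0
δ<-≥ {a} {zero}  _   = refl
δ<-≥ {a} {suc k} k<a = trans (cong₂ _+_ (δ<-≥ (<⇒≤ k<a)) (δ-≢ (>⇒≢ k<a))) refl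

δ<-< : ∀ {a k} → a < k → δ< a k ≡ 1
δ<-< {a} {suc k} a<1+k with m≤n⇒m<n∨m≡n (≤-pred a<1+k)
... | inj₁ a<k  = trans (cong₂ _+_ (δ<-< a<k) (δ-≢ (<⇒≢ a<k))) refl
... | inj₂ refl = cong₂ _+_ (δ<-≥ {a} ≤-refl) (δ-refl a)

-- Editing a matrix, and the effect on its complement

infixl 5 _[_,_]≔_
_[_,_]≔_ : ∀ {n} → Mat n → Fin n → Fin n → Bool → Mat n
M [ x , y ]≔ b = updateAt M x (λ r → updateAt r y (const b))

module _ {n} (M : Mat n) (x y : Fin n) (b : Bool) where

  ≔-row : (M [ x , y ]≔ b) x ≡ updateAt (M x) y (const b)
  ≔-row = updateAt-updates x M

  ≔-other-row : ∀ {h} → h ≢ x → (M [ x , y ]≔ b) h ≡ M h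
  ≔-other-row h≢x = updateAt-minimal _ x M h≢x

  ≔-hit : (M [ x , y ]≔ b) x y ≡ b
  ≔-hit = trans (cong (λ r → r y) ≔-row) (updateAt-updates y (M x))

  ≔-miss : ∀ {h k} → ¬ (h ≡ x × k ≡ y) → (M [ x , y ]≔ b) h k ≡ M h k
  ≔-miss {h} {k} ≢xy with h ≟ x | k ≟ y
  ... | yes refl | yes refl = contradiction (refl , refl) ≢xy
  ... | yes refl | no k≢y   = trans (cong (λ r → r k) ≔-row) (updateAt-minimal k y (M x) k≢y)
  ... | no h≢x   | _        = cong (λ r → r k) (≔-other-row h≢x)

  ≔-stays : ∀ {h k} → M h k ≡ b → (M [ x , y ]≔ b) h k ≡ b
  ≔-stays {h} {k} Mhk with h ≟ x | k ≟ y
  ... | yes refl | yes refl = ≔-hit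
  ... | yes refl | no k≢y   = trans (≔-miss (k≢y ∘ proj₂)) Mhk
  ... | no h≢x   | _        = trans (≔-miss (h≢x ∘ proj₁)) Mhk

  ≔-true-inv : ∀ {h k} → (M [ x , y ]≔ b) h k ≡ true →
               (h ≡ x × k ≡ y) ⊎ (¬ (h ≡ x × k ≡ y) × M h k ≡ true)
  ≔-true-inv {h} {k} e with h ≟ x | k ≟ y
  ... | yes refl | yes refl = inj₁ (refl , refl)
  ... | yes refl | no k≢y   = inj₂ (k≢y ∘ proj₂ , trans (sym (≔-miss (k≢y ∘ proj₂))) e)
  ... | no h≢x   | _        = inj₂ (h≢x ∘ proj₁ , trans (sym (≔-miss (h≢x ∘ proj₁))) e)

≔-cong : ∀ {n} {M M′ : Mat n} x y b → (∀ h k → M h k ≡ M′ h k) →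
         ∀ h k → (M [ x , y ]≔ b) h k ≡ (M′ [ x , y ]≔ b) h k
≔-cong {M = M} {M′} x y b M≗M′ h k with h ≟ x | k ≟ y
... | yes refl | yes refl = trans (≔-hit M x y b) (sym (≔-hit M′ x y b))
... | yes refl | no k≢y   = trans (≔-miss M x y b (k≢y ∘ proj₂)) (trans (M≗M′ h k) (sym (≔-miss M′ x y b (k≢y ∘ proj₂))))
... | no h≢x   | _        = trans (≔-miss M x y b (h≢x ∘ proj₁)) (trans (M≗M′ h k) (sym (≔-miss M′ x y b (h≢x ∘ proj₁))))

δ-toℕ-≢ : ∀ {n} {x i : Fin n} → i ≢ x → δ (toℕ x) (toℕ i) ≡ 0
δ-toℕ-≢ i≢x = δ-≢ (λ x≡i → i≢x (toℕ-injective (sym x≡i)))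

count-row-set-true : ∀ {n} (M : Mat n) {x y} → M x y ≡ false →
                     ∀ i → count ((M [ x , y ]≔ true) i) ≡ count (M i) + δ (toℕ x) (toℕ i)
count-row-set-true M {x} {y} Mxy i with i ≟ x
... | yes refl = trans (cong count (≔-row M x y true)) (trans (count-set-true (M x) Mxy) (cong (_+_ (count (M x))) (sym (δ-refl (toℕ x)))))
... | no i≢x   = trans (cong count (≔-other-row M x y true i≢x)) (sym (trans (cong (_+_ (count (M i))) (δ-toℕ-≢ i≢x)) (+-identityʳ _)))

count-row-set-false : ∀ {n} (M : Mat n) {x y} → M x y ≡ true →
                      ∀ i → count ((M [ x , y ]≔ false) i) + δ (toℕ x) (toℕ i) ≡ count (M i)
count-row-set-false M {x} {y} Mxy i with i ≟ x
... | yes refl = trans (cong₂ _+_ (cong count (≔-row M x y false)) (δ-refl (toℕ x))) (count-set-false (M x) Mxy)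
... | no i≢x   = trans (cong₂ _+_ (cong count (≔-other-row M x y false i≢x)) (δ-toℕ-≢ i≢x)) (+-identityʳ _)


record MovesOne {n} (M N : Mat n) (from to : Fin n) : Set where
  constructor moves-one
  field
    row-counts : ∀ i → count (N i) + δ (toℕ from) (toℕ i) ≡ count (M i) + δ (toℕ to) (toℕ i)

MovesOne-cong : ∀ {n} {M N N′ : Mat n} {a b} → (∀ h k → N h k ≡ N′ h k) → MovesOne M N a b → MovesOne M N′ a b
MovesOne-cong N≗N′ (moves-one move) = moves-one λ i → trans (cong (_+ _) (sym (count-cong (N≗N′ i)))) (move i)

move-by-≔ : ∀ {n} (M : Mat n) {x₀ y₀ x₁ y₁} → M x₀ y₀ ≡ true → M x₁ y₁ ≡ false →
            MovesOne M ((M [ x₀ , y₀ ]≔ false) [ x₁ , y₁ ]≔ true) x₀ x₁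
move-by-≔ {n} M {x₀} {y₀} {x₁} {y₁} M₀ M₁ = moves-one λ i → begin
  count (N i) + δ (toℕ x₀) (toℕ i)
    ≡⟨ cong (_+ δ (toℕ x₀) (toℕ i)) (count-row-set-true N₀ (≔-stays M x₀ y₀ false M₁) i) ⟩
  count (N₀ i) + δ (toℕ x₁) (toℕ i) + δ (toℕ x₀) (toℕ i)          ≡⟨ +-assoc (count (N₀ i)) _ _ ⟩
  count (N₀ i) + (δ (toℕ x₁) (toℕ i) + δ (toℕ x₀) (toℕ i))
    ≡⟨ cong (_+_ (count (N₀ i))) (+-comm (δ (toℕ x₁) (toℕ i)) _) ⟩
  count (N₀ i) + (δ (toℕ x₀) (toℕ i) + δ (toℕ x₁) (toℕ i))        ≡⟨ +-assoc (count (N₀ i)) _ _ ⟨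
  count (N₀ i) + δ (toℕ x₀) (toℕ i) + δ (toℕ x₁) (toℕ i)
    ≡⟨ cong (_+ δ (toℕ x₁) (toℕ i)) (count-row-set-false M M₀ i) ⟩
  count (M i) + δ (toℕ x₁) (toℕ i)                               ∎
  where
    open ≡-Reasoning
    N₀ : Mat n
    N₀ = M [ x₀ , y₀ ]≔ false
    N : Mat n
    N = N₀ [ x₁ , y₁ ]≔ true

move-by-≔′ : ∀ {n} (M : Mat n) {x₀ y₀ x₁ y₁} → M x₀ y₀ ≡ true → M x₁ y₁ ≡ false →
             MovesOne M ((M [ x₁ , y₁ ]≔ true) [ x₀ , y₀ ]≔ false) x₀ x₁
move-by-≔′ M {x₀} {y₀} {x₁} {y₁} M₀ M₁ = moves-one λ i →
  trans (count-row-set-false (M [ x₁ , y₁ ]≔ true) (≔-stays M x₁ y₁ true M₀) i) (count-row-set-true M M₁ i)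

move-row : ∀ {n} {M N : Mat n} {a b} → MovesOne M N a b → ∀ t → row N t + δ (toℕ a) t ≡ row M t + δ (toℕ b) t
move-row {n} {M} {N} {a} {b} move t with t <? n
... | yes t<n = begin
  rowSum N i + δ (toℕ a) t         ≡⟨ cong₂ _+_ (rowSum≡count N i) (cong (δ (toℕ a)) (sym (toℕ-fromℕ< t<n))) ⟩
  count (N i) + δ (toℕ a) (toℕ i)  ≡⟨ MovesOne.row-counts move i ⟩
  count (M i) + δ (toℕ b) (toℕ i)  ≡⟨ cong₂ _+_ (sym (rowSum≡count M i)) (cong (δ (toℕ b)) (toℕ-fromℕ< t<n)) ⟩
  rowSum M i + δ (toℕ b) t         ∎
  where
    open ≡-Reasoning
    i : Fin n
    i = fromℕ< t<n
... | no t≮n = cong₂ _+_ refl (trans (δ-≢ (<⇒≢ (<-≤-trans (toℕ<n a) (≮⇒≥ t≮n))))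
                                     (sym (δ-≢ (<⇒≢ (<-≤-trans (toℕ<n b) (≮⇒≥ t≮n))))))

move-prefix : ∀ {n} {M N : Mat n} {a b} → MovesOne M N a b →
              ∀ k → prefix N k + δ< (toℕ a) k ≡ prefix M k + δ< (toℕ b) k
move-prefix move zero    = refl
move-prefix {M = M} {N} {a} {b} move (suc k) = begin
  prefix N k + row N k + (δ< (toℕ a) k + δ (toℕ a) k)    ≡⟨ interchange (prefix N k) _ _ _ ⟩
  prefix N k + δ< (toℕ a) k + (row N k + δ (toℕ a) k)
    ≡⟨ cong₂ _+_ (move-prefix move k) (move-row {a = a} {b = b} move k) ⟩
  prefix M k + δ< (toℕ b) k + (row M k + δ (toℕ b) k)    ≡⟨ interchange (prefix M k) _ _ _ ⟩
  prefix M k + row M k + (δ< (toℕ b) k + δ (toℕ b) k)    ∎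
  where
    open ≡-Reasoning

prefix-move-above : ∀ {n} {M N : Mat n} {a b} → MovesOne M N a b →
                    ∀ {k} → toℕ a < k → toℕ b < k → prefix N k ≡ prefix M k
prefix-move-above {M = M} {N} {a} {b} move {k} a<k b<k =
  +-cancelʳ-≡ 1 _ _ (subst₂ (λ x y → prefix N k + x ≡ prefix M k + y) (δ<-< a<k) (δ<-< b<k) (move-prefix move k))

prefix-move-between : ∀ {n} {M N : Mat n} {a b} → MovesOne M N a b →
                      ∀ {k} → toℕ b < k → k ≤ toℕ a → prefix N k ≡ suc (prefix M k)
prefix-move-between {M = M} {N} {a} {b} move {k} b<k k≤a =
  trans (sym (+-identityʳ _))
        (trans (subst₂ (λ x y → prefix N k + x ≡ prefix M k + y) (δ<-≥ k≤a) (δ<-< b<k) (move-prefix move k))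
               (+-comm _ 1))


bar-diag : ∀ {n} (M : Mat n) i → bar M i i ≡ false
bar-diag M i with i ≟ i
... | yes _   = refl
... | no i≢i  = contradiction refl i≢i

bar-off : ∀ {n} (M : Mat n) {i j} → i ≢ j → bar M i j ≡ not (M (opposite j) (opposite i))
bar-off M {i} {j} i≢j with i ≟ j
... | yes i≡j = contradiction i≡j i≢j
... | no  _   = refl

opposite-injective : ∀ {n} {i j : Fin n} → opposite i ≡ opposite j → i ≡ j
opposite-injective {i = i} {j} eq = trans (sym (opposite-involutive i)) (trans (cong opposite eq) (opposite-involutive j))

opposite-flip : ∀ {n} {i j : Fin n} → i ≡ opposite j → opposite i ≡ j
opposite-flip {j = j} i≡j′ = trans (cong opposite i≡j′) (opposite-involutive j)

bar-≔ : ∀ {n} (M : Mat n) {x y} b → x ≢ y →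
        ∀ h k → bar (M [ x , y ]≔ b) h k ≡ (bar M [ opposite y , opposite x ]≔ not b) h k
bar-≔ M {x} {y} b x≢y h k with h ≟ k
... | yes refl = sym (trans (≔-miss (bar M) (opposite y) (opposite x) (not b)
                               (λ (h≡y′ , h≡x′) → x≢y (opposite-injective (trans (sym h≡x′) h≡y′))))
                            (bar-diag M h))
... | no h≢k with opposite k ≟ x | opposite h ≟ y
...   | yes refl | yes refl = trans (cong not (≔-hit M x y b))
                                    (sym (subst₂ (λ p q → (bar M [ p , q ]≔ not b) h k ≡ not b)
                                                 (sym (opposite-involutive h)) (sym (opposite-involutive k))
                                                 (≔-hit (bar M) h k (not b))))
...   | yes refl | no h′≢y  = trans (cong not (≔-miss M x y b (h′≢y ∘ proj₂)))
                                    (sym (trans (≔-miss (bar M) _ _ (not b) (h′≢y ∘ opposite-flip ∘ proj₁)) (bar-off M h≢k)))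
...   | no k′≢x  | _        = trans (cong not (≔-miss M x y b (k′≢x ∘ proj₁)))
                                    (sym (trans (≔-miss (bar M) _ _ (not b) (k′≢x ∘ opposite-flip ∘ proj₂)) (bar-off M h≢k)))

bar-opposite : ∀ {n} (M : Mat n) {i j} → i ≢ j → bar M (opposite j) (opposite i) ≡ not (M i j)
bar-opposite M {i} {j} i≢j = trans (bar-off M (i≢j ∘ sym ∘ opposite-injective))
  (cong not (cong₂ M (opposite-involutive i) (opposite-involutive j)))

bar-zero : ∀ {n} (M : Mat n) r {k} → opposite k ≡ opposite r ⊎ M (opposite k) (opposite r) ≡ true → bar M r k ≡ false
bar-zero M r {k} cases with r ≟ k
... | yes refl = refl
... | no r≢k with cases
...   | inj₁ k′≡r′ = contradiction (sym (opposite-injective k′≡r′)) r≢k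
...   | inj₂ M≡true = cong not M≡true

-- The parameter c(A) and the class 𝒮*(n)

<ᵇ≡true⇔ : ∀ {m n} → (m <ᵇ n) ≡ true ⇔ m < n
<ᵇ≡true⇔ {m} {n} = mk⇔ (<ᵇ⇒< m n ∘ Equivalence.from T-≡) (Equivalence.to T-≡ ∘ <⇒<ᵇ)

<ᵇ≡false⇒≥ : ∀ {m n} → (m <ᵇ n) ≡ false → n ≤ m
<ᵇ≡false⇒≥ {m} {n} e = ≮⇒≥ (λ m<n → contradiction (trans (sym e) (Equivalence.from <ᵇ≡true⇔ m<n)) λ ())

≥⇒<ᵇ≡false : ∀ {m n} → n ≤ m → (m <ᵇ n) ≡ false
≥⇒<ᵇ≡false {m} {n} n≤m with m <ᵇ n in e
... | false = refl
... | true  = contradiction n≤m (<⇒≱ (Equivalence.to <ᵇ≡true⇔ e))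

module _ {n} (M : Mat n) where

  private
    P : ℕ → Bool
    P i = (i * (i ∸ 1)) <ᵇ prefix M i

  prefix-cOf : 0 < cOf M → cOf M * (cOf M ∸ 1) < prefix M (cOf M)
  prefix-cOf 0<c = Equivalence.to <ᵇ≡true⇔ (maxSat-true P n 0<c)

  prefix-above-cOf : ∀ {i} → cOf M < i → i ≤ n → prefix M i ≤ i * (i ∸ 1)
  prefix-above-cOf c<i i≤n = <ᵇ≡false⇒≥ (maxSat-false P n c<i i≤n)

  cOf-≥ : ∀ {i} → i * (i ∸ 1) < prefix M i → i ≤ n → i ≤ cOf M
  cOf-≥ big i≤n = maxSat-≥ P n (Equivalence.from <ᵇ≡true⇔ big) i≤n

  cOf-≤ : ∀ m → (∀ i → m < i → i ≤ n → prefix M i ≤ i * (i ∸ 1)) → cOf M ≤ m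
  cOf-≤ m small = maxSat-≤-bound P n m (λ i m<i i≤n → ≥⇒<ᵇ≡false (small i m<i i≤n))

cOf-stable : ∀ {n} (M N : Mat n) → prefix M (cOf M) ≤ prefix N (cOf M) →
             (∀ k → cOf M < k → prefix N k ≡ prefix M k) → cOf N ≡ cOf M
cOf-stable {n} M N at-c above = maxSat-stable P Q n
  (λ Pc → Equivalence.from <ᵇ≡true⇔ (<-≤-trans (Equivalence.to <ᵇ≡true⇔ Pc) at-c))
  (λ i c<i _ → cong (i * (i ∸ 1) <ᵇ_) (above i c<i))
  where
    P Q : ℕ → Bool
    P i = (i * (i ∸ 1)) <ᵇ prefix M i
    Q i = (i * (i ∸ 1)) <ᵇ prefix N i

module Sstar {n} {A : Mat n} (A∈S* : InSstar A) where

  zero-diagonal : ∀ i → A i i ≡ false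
  zero-diagonal = proj₁ A∈S*

  one₁₂ : ∀ i j → toℕ i ≡ 0 → toℕ j ≡ 1 → A i j ≡ true
  one₁₂ = proj₁ (proj₂ A∈S*)

  one₂₁ : ∀ i j → toℕ i ≡ 1 → toℕ j ≡ 0 → A i j ≡ true
  one₂₁ = proj₁ (proj₂ (proj₂ A∈S*))

  zero₋₁ : ∀ i j → suc (suc (toℕ i)) ≡ n → suc (toℕ j) ≡ n → A i j ≡ false
  zero₋₁ = proj₁ (proj₂ (proj₂ (proj₂ A∈S*)))

  zero₋₂ : ∀ i j → suc (toℕ i) ≡ n → suc (suc (toℕ j)) ≡ n → A i j ≡ false
  zero₋₂ = proj₁ (proj₂ (proj₂ (proj₂ (proj₂ A∈S*))))

  closed : ∀ i j h k → A i j ≡ true → toℕ h ≤ toℕ i → toℕ k ≤ toℕ j → h ≢ k → A h k ≡ true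
  closed = proj₂ (proj₂ (proj₂ (proj₂ (proj₂ A∈S*))))

  suc-row≤ : ∀ {t} → t < n → suc (row A t) ≤ n
  suc-row≤ t<n = subst (λ r → suc r ≤ n) (sym (trans (cong (row A) (sym (toℕ-fromℕ< t<n))) (row-toℕ A _)))
                   (count<n (A _) (zero-diagonal (fromℕ< t<n)))

  cOf-pos : 2 ≤ n → 0 < cOf A
  cOf-pos 2≤n = cOf-≥ A (subst (0 <_) (sym (trans (cong (row A) (sym (toℕ-fromℕ< 0<n))) (row-toℕ A _)))
                                  (true⇒0<count (A _) (one₁₂ _ (fromℕ< 1<n) (toℕ-fromℕ< 0<n) (toℕ-fromℕ< 1<n))))
                          (<⇒≤ 1<n)
    where
      1<n : 1 < n
      1<n = 2≤n
      0<n : 0 < n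
      0<n = <-trans z<s 1<n

  module _ (0<v : 0 < vOf A) where

    cOf<n : cOf A < n
    cOf<n = row-index A 0<v

    sOf-pos : 0 < cOf A → 0 < sOf A
    sOf-pos 0<c = m<n⇒0<n∸m (prefix-cOf A 0<c)

    sOf+vOf≤2cOf : 0 < cOf A → sOf A + vOf A ≤ 2 * cOf A
    sOf+vOf≤2cOf 0<c = +-cancelʳ-≤ (c * (c ∸ 1)) _ _ (begin
      sOf A + vOf A + c * (c ∸ 1)           ≡⟨ +-assoc (sOf A) _ _ ⟩
      sOf A + (vOf A + c * (c ∸ 1))         ≡⟨ cong (_+_ (sOf A)) (+-comm (vOf A) _) ⟩
      sOf A + (c * (c ∸ 1) + vOf A)         ≡⟨ +-assoc (sOf A) _ _ ⟨
      sOf A + c * (c ∸ 1) + vOf A           ≡⟨ cong (_+ vOf A) (m∸n+n≡m (<⇒≤ (prefix-cOf A 0<c))) ⟩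
      prefix A (suc c)                      ≤⟨ prefix-above-cOf A ≤-refl cOf<n ⟩
      suc c * (suc c ∸ 1)                   ≡⟨ square-step c 0<c ⟩
      2 * c + c * (c ∸ 1)                   ∎)
      where
        open ≤-Reasoning
        c : ℕ
        c = cOf A
        square-step : ∀ c → 0 < c → suc c * c ≡ 2 * c + c * (c ∸ 1)
        square-step (suc k) _ = solve 1 (λ k → (con 2 :+ k) :* (con 1 :+ k) := con 2 :* (con 1 :+ k) :+ (con 1 :+ k) :* k) refl k
          where open +-*-Solver

-- Lowering v(A)

m∸n≤o⇒m∸o≤n : ∀ m {n o} → m ∸ n ≤ o → m ∸ o ≤ n
m∸n≤o⇒m∸o≤n m {n} {o} m∸n≤o =
  m≤n+o⇒m∸n≤o m o (≤-trans (m≤n+m∸n m n) (≤-trans (+-monoʳ-≤ n m∸n≤o) (≤-reflexive (+-comm n o))))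

record SameProfile {n} (A B : Mat n) : Set where
  field
    c≡  : cOf B ≡ cOf A
    sv≡ : sOf B + vOf B ≡ sOf A + vOf A
    c̄≡  : cOf (bar B) ≡ cOf (bar A)
    v̄≡  : vOf (bar B) ≡ vOf (bar A)
    s̄≡  : sOf (bar B) ≡ sOf (bar A)

module LoweringStep {n} (3≤n : 3 ≤ n) {A : Mat n} (A∈S* : InSstar A)
                    (v̄≡ : vOf (bar A) ≡ n ∸ cOf A ∸ 1) (n-c̄<v : n ∸ cOf (bar A) < vOf A) where

  open Sstar A∈S*
  open ≤-Reasoning

  c : ℕ
  c = cOf A
  v : ℕ
  v = vOf A
  c̄ : ℕ
  c̄ = cOf (bar A)
  v̄ : ℕ
  v̄ = vOf (bar A)

  0<v : 0 < v
  0<v = <-≤-trans z<s n-c̄<v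

  c<n : c < n
  c<n = cOf<n 0<v

  0<c : 0 < c
  0<c = cOf-pos (<⇒≤ 3≤n)

  -- Indices are 0-based: row cF is row c + 1 of the paper.
  cF : Fin n
  cF = fromℕ< c<n

  toℕ-cF : toℕ cF ≡ c
  toℕ-cF = toℕ-fromℕ< c<n

  v≡count : v ≡ count (A cF)
  v≡count = trans (cong (row A) (sym toℕ-cF)) (row-toℕ A cF)

  opaque
    last-one : ∃ λ j → A cF j ≡ true × (∀ k → toℕ j < toℕ k → ¬ A cF k ≡ true)
    last-one = greatest (λ j → A cF j ≡ true) (λ j → A cF j ≟ᵇ true)
                        (0<count⇒∃ (A cF) (subst (0 <_) v≡count 0<v))

  j₀ : Fin n
  j₀ = proj₁ last-one

  A-c-j₀ : A cF j₀ ≡ true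
  A-c-j₀ = proj₁ (proj₂ last-one)

  row-c-≤-j₀ : ∀ k → A cF k ≡ true → toℕ k ≤ toℕ j₀
  row-c-≤-j₀ k Ak = ≮⇒≥ (λ j₀<k → proj₂ (proj₂ last-one) k j₀<k Ak)

  v≤1+j₀ : v ≤ suc (toℕ j₀)
  v≤1+j₀ = subst (_≤ suc (toℕ j₀)) (sym v≡count) (count≤-support (suc (toℕ j₀)) (A cF) (λ k Ak → s≤s (row-c-≤-j₀ k Ak)))

  n-c̄≤j₀ : n ∸ c̄ ≤ toℕ j₀
  n-c̄≤j₀ = ≤-pred (<-≤-trans n-c̄<v v≤1+j₀)

  -- Row c̄ of Ā has v̄ = n − c − 1 ones, so column n − 1 − c̄ of A has (counting its diagonal
  -- entry) exactly c + 1 ones; rows 0, …, c already supply them all.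
  rows-below-c : ∀ i j → c < toℕ i → A i j ≡ true → toℕ j < n ∸ c̄
  rows-below-c i j c<i Aij with toℕ j <? n ∸ c̄
  ... | yes j<n-c̄ = j<n-c̄
  ... | no  j≮n-c̄ = contradiction overfull (<⇒≱ ≤-refl)
    where
      2+c≤n : suc (suc c) ≤ n
      2+c≤n = <-≤-trans (s≤s c<i) (toℕ<n i)
      v̄≡n∸1+c : v̄ ≡ n ∸ suc c
      v̄≡n∸1+c = trans v̄≡ (trans (∸-+-assoc n c 1) (cong (n ∸_) (+-comm c 1)))
      c̄<n : c̄ < n
      c̄<n = row-index (bar A) (subst (0 <_) (sym v̄≡n∸1+c) (m<n⇒0<n∸m 2+c≤n))
      r̄ : Fin n
      r̄ = fromℕ< c̄<n
      p : Fin n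
      p = opposite r̄
      toℕ-p : toℕ p ≡ n ∸ suc c̄
      toℕ-p = trans (opposite-prop r̄) (cong (λ t → n ∸ suc t) (toℕ-fromℕ< c̄<n))
      p≤ : ∀ {k} → n ∸ c̄ ≤ k → toℕ p ≤ k
      p≤ n-c̄≤k = ≤-trans (≤-reflexive toℕ-p) (≤-trans (∸-monoʳ-≤ n (n≤1+n c̄)) n-c̄≤k)
      column-p : ∀ h → toℕ h ≤ c → h ≡ p ⊎ A h p ≡ true
      column-p h h≤c with h ≟ p
      ... | yes h≡p = inj₁ h≡p
      ... | no  h≢p = inj₂ (closed cF j₀ h p A-c-j₀ (subst (toℕ h ≤_) (sym toℕ-cF) h≤c) (p≤ n-c̄≤j₀) h≢p)
      zeros : Fin n → Bool
      zeros k = not (bar A r̄ k)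
      zero-at : ∀ k → opposite k ≡ p ⊎ A (opposite k) p ≡ true → zeros k ≡ true
      zero-at k column = cong not (bar-zero A r̄ column)
      count-zeros : count zeros ≡ suc c
      count-zeros = begin-equality
        count zeros                                  ≡⟨ m+n∸m≡n (count (bar A r̄)) _ ⟨
        count (bar A r̄) + count zeros ∸ count (bar A r̄)
          ≡⟨ cong₂ _∸_ (count-complement (bar A r̄)) (sym (row-toℕ (bar A) r̄)) ⟩
        n ∸ row (bar A) (toℕ r̄)                      ≡⟨ cong (λ t → n ∸ row (bar A) t) (toℕ-fromℕ< c̄<n) ⟩
        n ∸ v̄                                        ≡⟨ cong (n ∸_) v̄≡n∸1+c ⟩
        n ∸ (n ∸ suc c)                              ≡⟨ m∸[m∸n]≡n (<⇒≤ 2+c≤n) ⟩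
        suc c                                        ∎
      overfull : suc (suc c) ≤ suc c
      overfull = begin
        suc (suc c)                 ≡⟨ cong suc (m∸[m∸n]≡n (<⇒≤ 2+c≤n)) ⟨
        suc (n ∸ (n ∸ suc c))       ≤⟨ count≥-tail+point (n ∸ suc c) zeros (opposite i)
                                         (λ k n-1-c≤k → zero-at k (column-p (opposite k) (opposite-≤ n-1-c≤k)))
                                         (zero-at (opposite i) (subst (λ h → h ≡ p ⊎ A h p ≡ true) (sym (opposite-involutive i)) i-in-column))
                                         (subst (_< n ∸ suc c) (sym (opposite-prop i)) (∸-monoʳ-< (s≤s c<i) (toℕ<n i))) ⟩
        count zeros                 ≡⟨ count-zeros ⟩
        suc c                       ∎
        where
          opposite-≤ : ∀ {k} → n ∸ suc c ≤ toℕ k → toℕ (opposite k) ≤ c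
          opposite-≤ {k} le = subst (_≤ c) (sym (opposite-prop k))
            (subst (_≤ c) (pred[m∸n]≡m∸[1+n] n (toℕ k)) (pred-mono-≤ (m∸n≤o⇒m∸o≤n n {suc c} le)))
          i-in-column : i ≡ p ⊎ A i p ≡ true
          i-in-column with i ≟ p
          ... | yes i≡p = inj₁ i≡p
          ... | no  i≢p = inj₂ (closed i j i p Aij ≤-refl (p≤ (≮⇒≥ j≮n-c̄)) i≢p)

  -- the entry (n − 1, n) of the paper, which 𝒮* keeps zero
  Corner : Fin n → Fin n → Set
  Corner i j = suc (suc (toℕ i)) ≡ n × suc (toℕ j) ≡ n

  Free : Fin n → Fin n → Set
  Free i j = toℕ i < c × i ≢ j × A i j ≡ false × ¬ Corner i j

  Corner? : ∀ i j → Dec (Corner i j)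
  Corner? i j = suc (suc (toℕ i)) ≟ℕ n ×-dec suc (toℕ j) ≟ℕ n

  Free? : ∀ i j → Dec (Free i j)
  Free? i j = toℕ i <? c ×-dec ¬? (i ≟ j) ×-dec A i j ≟ᵇ false ×-dec ¬? (Corner? i j)

  -- If rows 0, …, c − 1 were full, then c = n − 1 and every row of Ā would hold at most one
  -- one, forcing c̄ ≤ 1 and hence v > n − c̄ ≥ n − 1.
  free-exists : ∃ λ i → ∃ (Free i)
  free-exists with any? (λ i → any? (Free? i))
  ... | yes free = free
  ... | no  none = contradiction (≤-trans v≤n-1 (∸-monoʳ-≤ n c̄≤1)) (<⇒≱ n-c̄<v)
    where
      full : ∀ i j → toℕ i < c → i ≢ j → ¬ Corner i j → A i j ≡ true
      full i j i<c i≢j ¬corner with A i j in Aij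
      ... | true  = refl
      ... | false = contradiction (i<c , i≢j , Aij , ¬corner) (λ free → none (i , j , free))

      1+c≡n : suc c ≡ n
      1+c≡n with suc (suc c) ≤? n
      ... | no  2+c≰n = ≤-antisym c<n (≤-pred (≰⇒> 2+c≰n))
      ... | yes 2+c≤n = contradiction (prefix-above-cOf A ≤-refl c<n) (<⇒≱ (begin-strict
            suc c * c              ≡⟨ *-comm (suc c) c ⟩
            c * suc c              ≤⟨ *-monoʳ-≤ c (subst (suc c ≤_) (sym (pred[m∸n]≡m∸[1+n] n 0)) (pred-mono-≤ 2+c≤n)) ⟩
            c * (n ∸ 1)            ≤⟨ prefix-≥ A c (n ∸ 1) rows-full ⟩
            prefix A c             <⟨ m<m+n (prefix A c) 0<v ⟩
            prefix A (suc c)       ∎))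
        where
          rows-full : ∀ t → t < c → n ∸ 1 ≤ row A t
          rows-full t t<c = subst (n ∸ 1 ≤_) (sym (trans (cong (row A) (sym (toℕ-fromℕ< t<n))) (row-toℕ A i)))
            (m≤n+o⇒m∸n≤o n 1 (count-almost-full (A i) i
              (λ j j≢i → full i j (subst (_< c) (sym (toℕ-fromℕ< t<n)) t<c) (j≢i ∘ sym)
                         (λ (2+t≡n , _) → <⇒≢ (<-≤-trans (s≤s (s≤s (subst (_< c) (sym (toℕ-fromℕ< t<n)) t<c))) 2+c≤n) 2+t≡n))))
            where
              t<n : t < n
              t<n = <-trans t<c c<n
              i : Fin n
              i = fromℕ< t<n

      toℕ-from-opposite : ∀ (x : Fin n) {m} → toℕ (opposite x) + suc m ≡ n → toℕ x ≡ m
      toℕ-from-opposite x {m} eq = suc-injective (+-cancelˡ-≡ (toℕ (opposite x)) _ _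
        (trans (trans (cong (_+ suc (toℕ x)) (opposite-prop x)) (m∸n+n≡m (toℕ<n x))) (sym eq)))

      bar-ones : ∀ r k → bar A r k ≡ true → toℕ r ≡ 0 × toℕ k ≡ 1 ⊎ toℕ r ≢ 0 × toℕ k ≡ 0
      bar-ones r k bark with r ≟ k
      ... | yes refl = contradiction bark λ ()
      ... | no  r≢k with toℕ (opposite k) <? c
      ...   | yes k′<c = inj₁ (toℕ-from-opposite r (trans (+-comm _ 1) (proj₂ corner)) ,
                               toℕ-from-opposite k (trans (+-comm _ 2) (proj₁ corner)))
        where
          corner : Corner (opposite k) (opposite r)
          corner = decidable-stable (Corner? (opposite k) (opposite r))
            λ ¬corner → contradiction (trans (sym bark) (cong not (full _ _ k′<c (r≢k ∘ sym ∘ opposite-injective) ¬corner))) λ ()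
      ...   | no  k′≮c = inj₂ ((λ r≡0 → r≢k (toℕ-injective (trans r≡0 (sym k≡0)))) , k≡0)
        where
          k≡0 : toℕ k ≡ 0
          k≡0 = toℕ-from-opposite k (trans (+-comm _ 1) (≤-antisym (toℕ<n (opposite k)) (subst (_≤ suc (toℕ (opposite k))) 1+c≡n (s≤s (≮⇒≥ k′≮c)))))

      bar-row≤1 : ∀ t → row (bar A) t ≤ 1
      bar-row≤1 t with t <? n
      ... | no  _   = z≤n
      ... | yes t<n = subst (_≤ 1) (sym (rowSum≡count (bar A) r)) (count-unique (bar A r) unique)
        where
          r : Fin n
          r = fromℕ< t<n
          unique : ∀ k k′ → bar A r k ≡ true → bar A r k′ ≡ true → k ≡ k′
          unique k k′ bark bark′ with bar-ones r k bark | bar-ones r k′ bark′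
          ... | inj₁ (_ , k≡1)   | inj₁ (_ , k′≡1)   = toℕ-injective (trans k≡1 (sym k′≡1))
          ... | inj₂ (_ , k≡0)   | inj₂ (_ , k′≡0)   = toℕ-injective (trans k≡0 (sym k′≡0))
          ... | inj₁ (r≡0 , _)   | inj₂ (r≢0 , _)    = contradiction r≡0 r≢0
          ... | inj₂ (r≢0 , _)   | inj₁ (r≡0 , _)    = contradiction r≡0 r≢0

      c̄≤1 : c̄ ≤ 1
      c̄≤1 = cOf-≤ (bar A) 1 λ where
        (suc zero) (s≤s ()) _
        (suc (suc i)) _ _ → ≤-trans (prefix-≤ (bar A) (suc (suc i)) 1 bar-row≤1)
                                    (*-monoʳ-≤ (suc (suc i)) (s≤s z≤n))

      v≤n-1 : v ≤ n ∸ 1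
      v≤n-1 = subst (v ≤_) (pred[m∸n]≡m∸[1+n] n 0) (pred-mono-≤ (suc-row≤ c<n))

  opaque
    first-free-row : ∃ λ i → ∃ (Free i) × (∀ h → toℕ h < toℕ i → ¬ ∃ (Free h))
    first-free-row = least (λ i → ∃ (Free i)) (λ i → any? (Free? i)) free-exists

  i₁ : Fin n
  i₁ = proj₁ first-free-row

  opaque
    first-free-column : ∃ λ j → Free i₁ j × (∀ k → toℕ k < toℕ j → ¬ Free i₁ k)
    first-free-column = least (Free i₁) (Free? i₁) (proj₁ (proj₂ first-free-row))

  j₁ : Fin n
  j₁ = proj₁ first-free-column

  i₁<c : toℕ i₁ < c
  i₁<c = proj₁ (proj₁ (proj₂ first-free-column))

  i₁≢j₁ : i₁ ≢ j₁
  i₁≢j₁ = proj₁ (proj₂ (proj₁ (proj₂ first-free-column)))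

  A-i₁-j₁ : A i₁ j₁ ≡ false
  A-i₁-j₁ = proj₁ (proj₂ (proj₂ (proj₁ (proj₂ first-free-column))))

  ¬corner₁ : ¬ Corner i₁ j₁
  ¬corner₁ = proj₂ (proj₂ (proj₂ (proj₁ (proj₂ first-free-column))))

  full-before-i₁ : ∀ h k → toℕ h < toℕ i₁ → h ≢ k → A h k ≡ true
  full-before-i₁ h k h<i₁ h≢k with A h k in Ahk
  ... | true  = refl
  ... | false = contradiction (k , h<c , h≢k , Ahk , ¬corner) (proj₂ (proj₂ first-free-row) h h<i₁)
    where
      h<c : toℕ h < c
      h<c = <-trans h<i₁ i₁<c
      ¬corner : ¬ Corner h k
      ¬corner (2+h≡n , _) = <⇒≢ (≤-<-trans (≤-trans (s≤s h<i₁) i₁<c) c<n) 2+h≡n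

  full-before-j₁ : ∀ k → toℕ k < toℕ j₁ → i₁ ≢ k → A i₁ k ≡ true
  full-before-j₁ k k<j₁ i₁≢k with A i₁ k in Ai₁k
  ... | true  = refl
  ... | false = contradiction (i₁<c , i₁≢k , Ai₁k , ¬corner) (proj₂ (proj₂ first-free-column) k k<j₁)
    where
      ¬corner : ¬ Corner i₁ k
      ¬corner (_ , 1+k≡n) = <⇒≢ (<-≤-trans (s≤s k<j₁) (toℕ<n j₁)) 1+k≡n

  i₁≢cF : i₁ ≢ cF
  i₁≢cF i₁≡cF = <⇒≢ i₁<c (trans (cong toℕ i₁≡cF) toℕ-cF)

  j₀<j₁ : toℕ j₀ < toℕ j₁
  j₀<j₁ = ≰⇒> λ j₁≤j₀ →
    contradiction (trans (sym A-i₁-j₁) (closed cF j₀ i₁ j₁ A-c-j₀ (subst (toℕ i₁ ≤_) (sym toℕ-cF) (<⇒≤ i₁<c)) j₁≤j₀ i₁≢j₁))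
                  λ ()

  cF≢j₀ : cF ≢ j₀
  cF≢j₀ cF≡j₀ = contradiction (trans (sym A-c-j₀) (trans (cong (A cF) (sym cF≡j₀)) (zero-diagonal cF))) λ ()

  A₀ A₁ : Mat n
  A₀ = A [ cF , j₀ ]≔ false
  A₁ = A₀ [ i₁ , j₁ ]≔ true

  A₁-true : ∀ {h k} → A₁ h k ≡ true → h ≡ i₁ × k ≡ j₁ ⊎ ¬ (h ≡ cF × k ≡ j₀) × A h k ≡ true
  A₁-true A₁hk with ≔-true-inv A₀ i₁ j₁ true A₁hk
  ... | inj₁ at-new = inj₁ at-new
  ... | inj₂ (_ , A₀hk) with ≔-true-inv A cF j₀ false A₀hk
  ...   | inj₁ (refl , refl) = contradiction (trans (sym A₀hk) (≔-hit A cF j₀ false)) λ ()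
  ...   | inj₂ kept = inj₂ kept

  A₁-kept : ∀ {h k} → A h k ≡ true → ¬ (h ≡ cF × k ≡ j₀) → A₁ h k ≡ true
  A₁-kept Ahk ≢cj₀ = ≔-stays A₀ i₁ j₁ true (trans (≔-miss A cF j₀ false ≢cj₀) Ahk)

  A₁-new : A₁ i₁ j₁ ≡ true
  A₁-new = ≔-hit A₀ i₁ j₁ true

  A₁∈S* : InSstar A₁
  A₁∈S* = diagonal , one₁₂′ , one₂₁′ , zero₋₁′ , zero₋₂′ , closed′
    where
      diagonal : ∀ i → A₁ i i ≡ false
      diagonal i = ¬-not λ A₁ii → case A₁-true A₁ii of λ where
        (inj₁ (refl , i≡j₁)) → i₁≢j₁ i≡j₁
        (inj₂ (_ , Aii))     → contradiction (trans (sym Aii) (zero-diagonal i)) λ ()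

      one₁₂′ : ∀ i j → toℕ i ≡ 0 → toℕ j ≡ 1 → A₁ i j ≡ true
      one₁₂′ i j i≡0 j≡1 = A₁-kept (one₁₂ i j i≡0 j≡1)
        λ (i≡cF , _) → <⇒≢ 0<c (sym (trans (sym toℕ-cF) (trans (cong toℕ (sym i≡cF)) i≡0)))

      -- Entry (2, 1) is row c's last one only if c = 1 and v ≤ 1; then c̄ = n and v̄ = 0 = n − 2.
      one₂₁′ : ∀ i j → toℕ i ≡ 1 → toℕ j ≡ 0 → A₁ i j ≡ true
      one₂₁′ i j i≡1 j≡0 = A₁-kept (one₂₁ i j i≡1 j≡0) λ where
        (refl , refl) → <⇒≱ 3≤n (m∸n≡0⇒m≤n (begin-equality
          n ∸ 2          ≡⟨ cong (λ t → n ∸ suc t) (trans (sym toℕ-cF) i≡1) ⟨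
          n ∸ suc c      ≡⟨ trans (∸-+-assoc n c 1) (cong (n ∸_) (+-comm c 1)) ⟨
          n ∸ c ∸ 1      ≡⟨ v̄≡ ⟨
          v̄
            ≡⟨ row-≥ (bar A) (m∸n≡0⇒m≤n (n≤0⇒n≡0 (≤-pred (<-≤-trans n-c̄<v (subst (λ t → v ≤ suc t) j≡0 v≤1+j₀))))) ⟩
          0              ∎))

      zero₋₁′ : ∀ i j → suc (suc (toℕ i)) ≡ n → suc (toℕ j) ≡ n → A₁ i j ≡ false
      zero₋₁′ i j 2+i≡n 1+j≡n = ¬-not λ A₁ij → case A₁-true A₁ij of λ where
        (inj₁ (refl , refl)) → ¬corner₁ (2+i≡n , 1+j≡n)
        (inj₂ (_ , Aij))     → contradiction (trans (sym Aij) (zero₋₁ i j 2+i≡n 1+j≡n)) λ ()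

      zero₋₂′ : ∀ i j → suc (toℕ i) ≡ n → suc (suc (toℕ j)) ≡ n → A₁ i j ≡ false
      zero₋₂′ i j 1+i≡n 2+j≡n = ¬-not λ A₁ij → case A₁-true A₁ij of λ where
        (inj₁ (refl , refl)) → <⇒≢ (≤-<-trans i₁<c c<n) 1+i≡n
        (inj₂ (_ , Aij))     → contradiction (trans (sym Aij) (zero₋₂ i j 1+i≡n 2+j≡n)) λ ()

      closed′ : ∀ i j h k → A₁ i j ≡ true → toℕ h ≤ toℕ i → toℕ k ≤ toℕ j → h ≢ k → A₁ h k ≡ true
      closed′ i j h k A₁ij h≤i k≤j h≢k with A₁-true A₁ij
      ... | inj₁ (refl , refl) = below-new (m≤n⇒m<n∨m≡n h≤i)
        where
          below-new : toℕ h < toℕ i₁ ⊎ toℕ h ≡ toℕ i₁ → A₁ h k ≡ true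
          below-new (inj₁ h<i₁) = A₁-kept (full-before-i₁ h k h<i₁ h≢k)
            λ (h≡cF , _) → <⇒≢ (<-trans h<i₁ i₁<c) (trans (cong toℕ h≡cF) toℕ-cF)
          below-new (inj₂ h≡i₁) with toℕ-injective h≡i₁ | m≤n⇒m<n∨m≡n k≤j
          ... | refl | inj₁ k<j₁ = A₁-kept (full-before-j₁ k k<j₁ h≢k) (i₁≢cF ∘ proj₁)
          ... | refl | inj₂ k≡j₁ with toℕ-injective k≡j₁
          ...   | refl = A₁-new
      ... | inj₂ (≢cj₀ , Aij) = A₁-kept (closed i j h k Aij h≤i k≤j h≢k) not-removed
        where
          -- no one lies right of (c, j₀) by the choice of j₀, nor below and right of it by
          -- rows-below-c, as j₀ ≥ n − c̄
          not-removed : ¬ (h ≡ cF × k ≡ j₀)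
          not-removed (refl , refl) with m≤n⇒m<n∨m≡n h≤i | m≤n⇒m<n∨m≡n k≤j
          ... | inj₁ c<i | _ = <⇒≱ (rows-below-c i j (subst (_< toℕ i) toℕ-cF c<i) Aij) (≤-trans n-c̄≤j₀ k≤j)
          ... | inj₂ c≡i | inj₁ j₀<j = <⇒≱ j₀<j (row-c-≤-j₀ j (subst (λ x → A x j ≡ true) (sym (toℕ-injective c≡i)) Aij))
          ... | inj₂ c≡i | inj₂ j₀≡j = ≢cj₀ (sym (toℕ-injective c≡i) , sym (toℕ-injective j₀≡j))

  move : MovesOne A A₁ cF i₁
  move = move-by-≔ A A-c-j₀ A-i₁-j₁

  prefix-A₁-c : prefix A₁ c ≡ suc (prefix A c)
  prefix-A₁-c = prefix-move-between move i₁<c (≤-reflexive (sym toℕ-cF))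

  c₁≡c : cOf A₁ ≡ c
  c₁≡c = cOf-stable A A₁ (≤-trans (n≤1+n _) (≤-reflexive (sym prefix-A₁-c)))
           (λ k c<k → prefix-move-above move (subst (_< k) (sym toℕ-cF) c<k) (<-trans i₁<c c<k))

  1+v₁≡v : suc (vOf A₁) ≡ v
  1+v₁≡v = begin-equality
    suc (row A₁ (cOf A₁))              ≡⟨ cong (λ t → suc (row A₁ t)) c₁≡c ⟩
    suc (row A₁ c)                     ≡⟨ +-comm 1 _ ⟩
    row A₁ c + 1                       ≡⟨ cong (_+_ (row A₁ c)) (trans (cong (λ t → δ t c) toℕ-cF) (δ-refl c)) ⟨
    row A₁ c + δ (toℕ cF) c            ≡⟨ move-row {a = cF} {b = i₁} move c ⟩
    row A c + δ (toℕ i₁) c             ≡⟨ cong (_+_ (row A c)) (δ-≢ (<⇒≢ i₁<c)) ⟩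
    row A c + 0                        ≡⟨ +-identityʳ _ ⟩
    v                                  ∎

  s₁≡1+s : sOf A₁ ≡ suc (sOf A)
  s₁≡1+s = begin-equality
    prefix A₁ (cOf A₁) ∸ cOf A₁ * (cOf A₁ ∸ 1)   ≡⟨ cong (λ t → prefix A₁ t ∸ t * (t ∸ 1)) c₁≡c ⟩
    prefix A₁ c ∸ c * (c ∸ 1)                     ≡⟨ cong (_∸ c * (c ∸ 1)) prefix-A₁-c ⟩
    suc (prefix A c) ∸ c * (c ∸ 1)                ≡⟨ +-∸-assoc 1 (<⇒≤ (prefix-cOf A 0<c)) ⟩
    suc (sOf A)                                   ∎

  -- In Ā₁ the one moves from row n − 1 − j₁ to row n − 1 − j₀, both above c̄ since j₁ > j₀ ≥ n − c̄.
  bar-A₁ : ∀ h k → bar A₁ h k ≡ ((bar A [ opposite j₀ , opposite cF ]≔ true) [ opposite j₁ , opposite i₁ ]≔ false) h k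
  bar-A₁ h k = trans (bar-≔ A₀ true i₁≢j₁ h k) (≔-cong _ _ false (bar-≔ A false cF≢j₀) h k)

  movē : MovesOne (bar A) (bar A₁) (opposite j₁) (opposite j₀)
  movē = MovesOne-cong (λ h k → sym (bar-A₁ h k))
           (move-by-≔′ (bar A) (trans (bar-opposite A i₁≢j₁) (cong not A-i₁-j₁))
                               (trans (bar-opposite A cF≢j₀) (cong not A-c-j₀)))

  opposite-<c̄ : ∀ j → n ∸ c̄ ≤ toℕ j → toℕ (opposite j) < c̄
  opposite-<c̄ j n-c̄≤j = subst (_< c̄) (sym (opposite-prop j))
    (subst (_≤ c̄) (+-∸-assoc 1 (toℕ<n j)) (m∸n≤o⇒m∸o≤n n {c̄} {toℕ j} n-c̄≤j))

  opposite-j₀<c̄ : toℕ (opposite j₀) < c̄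
  opposite-j₀<c̄ = opposite-<c̄ j₀ n-c̄≤j₀

  opposite-j₁<c̄ : toℕ (opposite j₁) < c̄
  opposite-j₁<c̄ = opposite-<c̄ j₁ (≤-trans n-c̄≤j₀ (<⇒≤ j₀<j₁))

  prefix-bar-A₁ : ∀ k → c̄ ≤ k → prefix (bar A₁) k ≡ prefix (bar A) k
  prefix-bar-A₁ k c̄≤k = prefix-move-above movē (<-≤-trans opposite-j₁<c̄ c̄≤k) (<-≤-trans opposite-j₀<c̄ c̄≤k)

  c̄₁≡c̄ : cOf (bar A₁) ≡ c̄
  c̄₁≡c̄ = cOf-stable (bar A) (bar A₁) (≤-reflexive (sym (prefix-bar-A₁ c̄ ≤-refl)))
                     (λ k c̄<k → prefix-bar-A₁ k (<⇒≤ c̄<k))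

  same-profile : SameProfile A A₁
  same-profile = record
    { c≡  = c₁≡c
    ; sv≡ = trans (cong (_+ vOf A₁) s₁≡1+s) (trans (sym (+-suc (sOf A) _)) (cong (_+_ (sOf A)) 1+v₁≡v))
    ; c̄≡  = c̄₁≡c̄
    ; v̄≡  = v̄₁≡v̄
    ; s̄≡  = trans (cong (λ t → prefix (bar A₁) t ∸ t * (t ∸ 1)) c̄₁≡c̄)
                  (cong (_∸ c̄ * (c̄ ∸ 1)) (prefix-bar-A₁ c̄ ≤-refl))
    }
    where
      v̄₁≡v̄ : vOf (bar A₁) ≡ v̄
      v̄₁≡v̄ = begin-equality
        row (bar A₁) (cOf (bar A₁))                    ≡⟨ cong (row (bar A₁)) c̄₁≡c̄ ⟩
        row (bar A₁) c̄                                 ≡⟨ +-identityʳ _ ⟨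
        row (bar A₁) c̄ + 0
          ≡⟨ cong (_+_ (row (bar A₁) c̄)) (δ-≢ (<⇒≢ opposite-j₁<c̄)) ⟨
        row (bar A₁) c̄ + δ (toℕ (opposite j₁)) c̄       ≡⟨ move-row {a = opposite j₁} {b = opposite j₀} movē c̄ ⟩
        row (bar A) c̄ + δ (toℕ (opposite j₀)) c̄
          ≡⟨ cong (_+_ (row (bar A) c̄)) (δ-≢ (<⇒≢ opposite-j₀<c̄)) ⟩
        row (bar A) c̄ + 0                              ≡⟨ +-identityʳ _ ⟩
        v̄                                              ∎

SameProfile-refl : ∀ {n} {A : Mat n} → SameProfile A A
SameProfile-refl = record { c≡ = refl ; sv≡ = refl ; c̄≡ = refl ; v̄≡ = refl ; s̄≡ = refl }

SameProfile-trans : ∀ {n} {A B C : Mat n} → SameProfile A B → SameProfile B C → SameProfile A C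
SameProfile-trans AB BC = record
  { c≡  = trans (c≡ BC) (c≡ AB)
  ; sv≡ = trans (sv≡ BC) (sv≡ AB)
  ; c̄≡  = trans (c̄≡ BC) (c̄≡ AB)
  ; v̄≡  = trans (v̄≡ BC) (v̄≡ AB)
  ; s̄≡  = trans (s̄≡ BC) (s̄≡ AB)
  }
  where open SameProfile

lower-v : ∀ {n} → 3 ≤ n → ∀ d {A : Mat n} → InSstar A → vOf (bar A) ≡ n ∸ cOf A ∸ 1 →
          ∀ {v′} → n ∸ cOf (bar A) ≤ v′ → vOf A ≡ d + v′ →
          Σ (Mat n) λ B → InSstar B × SameProfile A B × vOf B ≡ v′
lower-v 3≤n zero    {A} A∈S* _ _ v≡d+v′ = A , A∈S* , SameProfile-refl , v≡d+v′
lower-v {n} 3≤n (suc d) {A} A∈S* v̄≡n∸c∸1 {v′} n-c̄≤v′ v≡d+v′ =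
  let B , B∈S* , A₁~B , v-B≡v′ =
        lower-v 3≤n d A₁∈S* v̄₁≡n∸c₁∸1 n-c̄₁≤v′ (suc-injective (trans 1+v₁≡v v≡d+v′))
  in B , B∈S* , SameProfile-trans same-profile A₁~B , v-B≡v′
  where
    n-c̄<v : n ∸ cOf (bar A) < vOf A
    n-c̄<v = subst (n ∸ cOf (bar A) <_) (sym v≡d+v′) (s≤s (≤-trans n-c̄≤v′ (m≤n+m v′ d)))
    open LoweringStep 3≤n A∈S* v̄≡n∸c∸1 n-c̄<v
    open SameProfile same-profile
    v̄₁≡n∸c₁∸1 : vOf (bar A₁) ≡ n ∸ cOf A₁ ∸ 1
    v̄₁≡n∸c₁∸1 = trans v̄≡ (trans v̄≡n∸c∸1 (cong (λ t → n ∸ t ∸ 1) (sym c≡)))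
    n-c̄₁≤v′ : n ∸ cOf (bar A₁) ≤ v′
    n-c̄₁≤v′ = subst (λ t → n ∸ t ≤ v′) (sym c̄≡) n-c̄≤v′

φ-lowered : ∀ {n} → 3 ≤ n → {A A₂ : Mat n} → InSstar A → SameProfile A A₂ → vOf A₂ < vOf A →
            φ A ≤ℝ φ A₂ × (φ A ≈ℝ φ A₂ ⇔ vOf A + sOf A ≡ 2 * cOf A)
φ-lowered 3≤n {A} {A₂} A∈S* same v₂<v =
  subst (λ c → φ A ≤ℝ φ′ c (vOf A₂) (sOf A₂) × (φ A ≈ℝ φ′ c (vOf A₂) (sOf A₂) ⇔ vOf A + sOf A ≡ 2 * cOf A))
        (sym c≡)
        (φ′-trade {cOf A} {vOf A} {sOf A} {vOf A₂} {sOf A₂} (sOf-pos 0<v 0<c) (sOf+vOf≤2cOf 0<v 0<c) v₂<v sv≡)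
  where
    open SameProfile same
    open Sstar A∈S*
    0<v : 0 < vOf A
    0<v = ≤-<-trans z≤n v₂<v
    0<c : 0 < cOf A
    0<c = cOf-pos (<⇒≤ 3≤n)

φ-bar-same : ∀ {n} {A A₂ : Mat n} → SameProfile A A₂ → φ (bar A) ≈ℝ φ (bar A₂)
φ-bar-same {A = A} {A₂} same = subst (λ x → φ (bar A) ≈ℝ x) (sym φ̄₂≡) ((λ _ q≤ → q≤) , (λ _ q≤ → q≤))
  where
    open SameProfile same
    φ̄₂≡ : φ (bar A₂) ≡ φ (bar A)
    φ̄₂≡ = trans (cong₂ (λ c v → φ′ c v (sOf (bar A₂))) c̄≡ v̄≡) (cong (φ′ (cOf (bar A)) (vOf (bar A))) s̄≡)

lemma3p4 : (n : ℕ) → 3 ≤ n → (A : Mat n) → InSstar A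
    → (v' : ℕ) → n ∸ cOf (bar A) ≤ v' → v' < vOf A
    → vOf (bar A) ≡ n ∸ cOf A ∸ 1
    → Σ (Mat n) (λ A₂ → InSstar A₂
        × cOf A₂ ≡ cOf A
        × vOf A₂ ≡ v'
        × sOf A₂ + vOf A₂ ≡ sOf A + vOf A
        × cOf (bar A₂) ≡ cOf (bar A)
        × vOf (bar A₂) ≡ vOf (bar A)
        × sOf (bar A₂) ≡ sOf (bar A)
        × φ A ≤ℝ φ A₂
        × φ (bar A) ≈ℝ φ (bar A₂)
        × (φ A ≈ℝ φ A₂ ⇔ vOf A + sOf A ≡ 2 * cOf A))
lemma3p4 n 3≤n A A∈S* v′ n-c̄≤v′ v′<v v̄≡n∸c∸1 =
  let A₂ , A₂∈S* , same , v₂≡v′ =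
        lower-v 3≤n (vOf A ∸ v′) A∈S* v̄≡n∸c∸1 n-c̄≤v′ (sym (m∸n+n≡m (<⇒≤ v′<v)))
      open SameProfile same
      φ≤ , φ≈⇔ = φ-lowered 3≤n A∈S* same (subst (_< vOf A) (sym v₂≡v′) v′<v)
  in A₂ , A₂∈S* , c≡ , v₂≡v′ , sv≡ , c̄≡ , v̄≡ , s̄≡ , φ≤ , φ-bar-same same , φ≈⇔
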